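{- Let $A, B \in \mathbb{N}$ and let $p > 3$ be a prime. For integers $n \geq 0$ define $$C(n, A, B) := \sum_{k=0}^{n} \binom{n}{k}^{A} \binom{2k}{k}^{B}.$$ Then for any $m, r \in \mathbb{N}$ we have $$C(mp^r, A, B) \equiv C(mp^{r-1}, A, B) \pmod{p^{3r}}$$ if $A \geq 3$, and $$C(mp^r, 2, B) \equiv C(mp^{r-1}, 2, B) \pmod{p^{2r}}.$$
   Context: $\mathbb{N}$ denotes the natural numbers as in the paper; in particular $r \geq 1$. -}

module Defs where

open import Data.Nat using (ℕ; zero; suc; _+_; _*_; _^_)
open import Data.Nat.Combinatorics using (_C_)
open import Data.Integer using (ℤ; +_; _-_)
open import Data.Integer.Divisibility using (_∣_)

sumTo : ℕ → (ℕ → ℕ) → ℕ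
sumTo zero    f = f 0
sumTo (suc n) f = sumTo n f + f (suc n)

Cfun : ℕ → ℕ → ℕ → ℕ
Cfun n A B = sumTo n (λ k → ((n C k) ^ A) * (((2 * k) C k) ^ B))

_≡_[mod_] : ℕ → ℕ → ℕ → Set
a ≡ b [mod M ] = (+ M) ∣ ((+ a) - (+ b))

-- Only the terms with p ∣ k matter: for p ∤ k, p^r divides C(mp^r, k), so C(mp^r, k)^A vanishes
-- modulo p^{Ar}. The term at k = jp is compared with the term at j of C(mp^{r-1}, A, B) through
-- Jacobsthal's congruence. Let D(N) be the product of the integers i < N prime to p and
-- P(N, x) = ∏ (x + i) over the same i; then D(bp) C((b+c)p, bp) = C(b+c, b) P(bp, cp), and
-- P(bp, cp) ≡ D(bp) modulo p^{3(s+1)} when p^s divides b and c. Together with p^e ∣ C(b+c, b)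
-- this makes the two terms agree modulo p^{eA+3(s+1)}, which is at least p^{3r} for A ≥ 3 and
-- p^{2r} for A = 2.
--
-- For Jacobsthal's congruence write P(N, x) = D + S₁ x + x² V(x) with N = bp. As p is odd,
-- P(N, −N) = D, so S₁ = N V(−N) and P(N, x) − D = x (x + N) (V(0) + x(…) − N(…)), a product of
-- three multiples of p^{s+1} once p^{s+1} ∣ V(0). That follows from 2 D V(0) = S₁² − Σᵢ (D/i)²:
-- modulo p^{s+1} the last sum is D² Σ j² over the inverses j of the units i, and a sum of squares
-- of the units below a multiple of p^{s+1} vanishes modulo p^{s+1} because p ∤ 6.

module Submission where

-- A separate module, so that the integer operators opened in it do not clash with the ℕ operators
-- of the statement at the end.
module BinomialSumCongruences where

  open import Defs
  open import Data.Nat.Base as ℕ using (ℕ; zero; suc; _<_; _≤_; z≤n; s≤s; _∸_; _!)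
  import Data.Nat.Properties as ℕ
  open import Data.Nat.Divisibility as ℕ using (divides; _∣?_; n∣m*n)
  import Data.Nat.DivMod as ℕ
  open import Data.Nat.Combinatorics using (_C_; nCk≡n!/k![n-k]!; k![n∸k]!∣n!; k>n⇒nCk≡0)
  open import Data.Nat.Primality using (Prime; euclidsLemma; prime⇒irreducible; prime⇒nonZero; prime⇒nonTrivial)
  open import Data.Nat.Coprimality using (Coprime; coprime-divisor)
  import Data.Nat.Coprimality as Coprimality
  open import Data.Nat.GCD using (module Bézout)
  open import Data.Integer.Base hiding (_<_; _≤_; _>_; _≥_; suc; pred; _/_; _%_)
  open import Data.Integer.DivMod using (n%ℕd<d; a≡a%ℕn+[a/ℕn]*n)
  open import Data.Integer.Properties hiding (≤-refl)
  open import Data.Integer.Divisibility.Signed hiding (_∣?_)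
  open import Data.Integer.Divisibility.Signed using () renaming (_∣?_ to _∣ℤ?_)
  open import Data.Integer.Tactic.RingSolver
  import Data.Nat.Tactic.RingSolver as ℕ
  open import Algebra.Core using (Op₂)
  open import Algebra.Structures using (IsCommutativeMonoid)
  open import Algebra.Bundles using (CommutativeMonoid)
  import Algebra.Properties.CommutativeSemigroup as CommutativeSemigroupProperties
  open import Relation.Binary.Bundles using (Setoid)
  open import Relation.Binary.Structures using (IsEquivalence)
  import Relation.Binary.Reasoning.Setoid as SetoidReasoning
  open import Relation.Binary.PropositionalEquality
  open import Function.Base using (_∘_; case_of_)
  open import Relation.Nullary using (¬_; Dec; yes; no)
  open import Data.Empty using (⊥-elim)
  open import Data.Product using (∃; _×_; _,_)
  open import Data.Sum using (_⊎_; inj₁; inj₂; [_,_]′)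

  open CommutativeSemigroupProperties *-commutativeSemigroup using (xy∙z≈xz∙y; x∙yz≈y∙xz)

  -- Congruences of integers

  infix 4 _≋_[mod_]
  -- A record rather than m ∣ a - b itself, so that unification recovers a, b and m.
  record _≋_[mod_] (a b m : ℤ) : Set where
    constructor ≋-intro
    field ∣-difference : m ∣ a - b
  open _≋_[mod_] public

  module _ {m : ℤ} where

    ≋-isEquivalence : IsEquivalence (_≋_[mod m ])
    ≋-isEquivalence = record
      { refl  = λ {a} → ≋-intro (divides 0ℤ (+-inverseʳ a))
      ; sym   = λ {a} {b} (≋-intro d) → ≋-intro (subst (m ∣_) (neg-minus a b) (∣m⇒∣-m d))
      ; trans = λ {a} {b} {c} (≋-intro d) (≋-intro e) → ≋-intro (subst (m ∣_) (minus-trans a b c) (∣m∣n⇒∣m+n d e))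
      }
      where
      neg-minus : ∀ a b → - (a - b) ≡ b - a
      neg-minus = solve-∀
      minus-trans : ∀ a b c → (a - b) + (b - c) ≡ a - c
      minus-trans = solve-∀

    open IsEquivalence ≋-isEquivalence public
      using () renaming (refl to ≋-refl; trans to ≋-trans; reflexive to ≋-reflexive)

  ≋-setoid : ℤ → Setoid _ _
  ≋-setoid m = record { isEquivalence = ≋-isEquivalence {m} }

  module ≋-Reasoning (m : ℤ) = SetoidReasoning (≋-setoid m)

  ≋-+ : ∀ {m a b c d} → a ≋ b [mod m ] → c ≋ d [mod m ] → a + c ≋ b + d [mod m ]
  ≋-+ {a = a} {b} {c} {d} (≋-intro ab) (≋-intro cd) = ≋-intro (subst (_ ∣_) (regroup a b c d) (∣m∣n⇒∣m+n ab cd))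
    where
    regroup : ∀ a b c d → (a - b) + (c - d) ≡ a + c - (b + d)
    regroup = solve-∀

  ≋-*ˡ : ∀ {m a b} k → a ≋ b [mod m ] → k * a ≋ k * b [mod m ]
  ≋-*ˡ {a = a} {b} k (≋-intro ab) = ≋-intro (subst (_ ∣_) (distrib k a b) (∣n⇒∣m*n k ab))
    where
    distrib : ∀ k a b → k * (a - b) ≡ k * a - k * b
    distrib = solve-∀

  ≋-*ʳ : ∀ {m a b} k → a ≋ b [mod m ] → a * k ≋ b * k [mod m ]
  ≋-*ʳ {a = a} {b} k ab = subst₂ (_≋_[mod _ ]) (*-comm k a) (*-comm k b) (≋-*ˡ k ab)

  ≋-* : ∀ {m a b c d} → a ≋ b [mod m ] → c ≋ d [mod m ] → a * c ≋ b * d [mod m ]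
  ≋-* {b = b} {c = c} ab cd = ≋-trans (≋-*ʳ c ab) (≋-*ˡ b cd)

  ≋-weaken : ∀ {m m′ a b} → m′ ∣ m → a ≋ b [mod m ] → a ≋ b [mod m′ ]
  ≋-weaken m′∣m (≋-intro m∣a-b) = ≋-intro (∣-trans m′∣m m∣a-b)

  x-y∣xⁿ-yⁿ : ∀ x y n → (x - y) ∣ (x ^ n - y ^ n)
  x-y∣xⁿ-yⁿ x y zero = divides 0ℤ refl
  x-y∣xⁿ-yⁿ x y (suc n) with x-y∣xⁿ-yⁿ x y n
  ... | divides q eq = divides (x * q + y ^ n) (begin
      x * x ^ n - y * y ^ n                  ≡⟨ telescope x y (x ^ n) (y ^ n) ⟩
      x * (x ^ n - y ^ n) + y ^ n * (x - y)  ≡⟨ cong (λ z → x * z + y ^ n * (x - y)) eq ⟩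
      x * (q * (x - y)) + y ^ n * (x - y)    ≡⟨ collect x y q (y ^ n) ⟩
      (x * q + y ^ n) * (x - y)              ∎)
    where
    open ≡-Reasoning
    telescope : ∀ x y a b → x * a - y * b ≡ x * (a - b) + b * (x - y)
    telescope = solve-∀
    collect : ∀ x y q b → x * (q * (x - y)) + b * (x - y) ≡ (x * q + b) * (x - y)
    collect = solve-∀

  ≋-^ : ∀ {m a b} n → a ≋ b [mod m ] → a ^ n ≋ b ^ n [mod m ]
  ≋-^ {a = a} {b} n (≋-intro ab) = ≋-intro (∣-trans ab (x-y∣xⁿ-yⁿ a b n))

  ∣⇒≋0 : ∀ {m a} → m ∣ a → a ≋ 0ℤ [mod m ]
  ∣⇒≋0 {a = a} d = ≋-intro (subst (_ ∣_) (sym (+-identityʳ a)) d)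

  ≋0⇒∣ : ∀ {m a} → a ≋ 0ℤ [mod m ] → m ∣ a
  ≋0⇒∣ {a = a} (≋-intro d) = subst (_ ∣_) (+-identityʳ a) d

  -- Sums and products over ranges

  module BigOperator {A : Set} {_∙_ : Op₂ A} {ε : A} (isCM : IsCommutativeMonoid _≡_ _∙_ ε) where

    open IsCommutativeMonoid isCM using (assoc; identityˡ; identityʳ; comm)
    private
      commutativeMonoid : CommutativeMonoid _ _
      commutativeMonoid = record { isCommutativeMonoid = isCM }
    open CommutativeSemigroupProperties (CommutativeMonoid.commutativeSemigroup commutativeMonoid)
      using (interchange)

    ⨁ : ℕ → (ℕ → A) → A
    ⨁ zero    f = ε
    ⨁ (suc n) f = ⨁ n f ∙ f n

    ⨁-cong : ∀ n {f g} → (∀ i → i < n → f i ≡ g i) → ⨁ n f ≡ ⨁ n g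
    ⨁-cong zero    f≗g = refl
    ⨁-cong (suc n) f≗g = cong₂ _∙_ (⨁-cong n (λ i i<n → f≗g i (ℕ.m≤n⇒m≤1+n i<n))) (f≗g n ℕ.≤-refl)

    ⨁-ε : ∀ n {f} → (∀ i → i < n → f i ≡ ε) → ⨁ n f ≡ ε
    ⨁-ε zero    f≗ε = refl
    ⨁-ε (suc n) f≗ε = begin
      ⨁ n _ ∙ _ ≡⟨ cong₂ _∙_ (⨁-ε n (λ i i<n → f≗ε i (ℕ.m≤n⇒m≤1+n i<n))) (f≗ε n ℕ.≤-refl) ⟩
      ε ∙ ε     ≡⟨ identityˡ ε ⟩
      ε         ∎
      where open ≡-Reasoning

    ⨁-+ : ∀ m n f → ⨁ (m ℕ.+ n) f ≡ ⨁ m f ∙ ⨁ n (λ k → f (m ℕ.+ k))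
    ⨁-+ m zero    f rewrite ℕ.+-identityʳ m = sym (identityʳ _)
    ⨁-+ m (suc n) f rewrite ℕ.+-suc m n | ⨁-+ m n f = assoc _ _ _

    ⨁-* : ∀ q b f → ⨁ (b ℕ.* q) f ≡ ⨁ b (λ t → ⨁ q (λ k → f (t ℕ.* q ℕ.+ k)))
    ⨁-* q zero    f = refl
    ⨁-* q (suc b) f rewrite ℕ.+-comm q (b ℕ.* q) | ⨁-+ (b ℕ.* q) q f | ⨁-* q b f = refl

    ⨁-suc : ∀ n f → ⨁ (suc n) f ≡ f 0 ∙ ⨁ n (f ∘ suc)
    ⨁-suc zero    f = trans (identityˡ (f 0)) (sym (identityʳ (f 0)))
    ⨁-suc (suc n) f rewrite ⨁-suc n f = assoc _ _ _

    ⨁-reverse : ∀ n f → ⨁ n f ≡ ⨁ n (λ i → f (n ∸ suc i))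
    ⨁-reverse zero    f = refl
    ⨁-reverse (suc n) f rewrite ⨁-suc n (λ i → f (n ∸ i)) | sym (⨁-reverse n f) = comm _ _

    ⨁-∙ : ∀ n f g → ⨁ n (λ i → f i ∙ g i) ≡ ⨁ n f ∙ ⨁ n g
    ⨁-∙ zero    f g = sym (identityˡ ε)
    ⨁-∙ (suc n) f g rewrite ⨁-∙ n f g = interchange _ _ _ _

    ⨁-swap : ∀ n m (f : ℕ → ℕ → A) → ⨁ n (λ i → ⨁ m (f i)) ≡ ⨁ m (λ j → ⨁ n (λ i → f i j))
    ⨁-swap zero    m f = sym (⨁-ε m (λ _ _ → refl))
    ⨁-swap (suc n) m f rewrite ⨁-swap n m f = sym (⨁-∙ m (λ j → ⨁ n (λ i → f i j)) (f n))

  module ∑ = BigOperator +-0-isCommutativeMonoid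
  module ∏ = BigOperator *-1-isCommutativeMonoid

  ∑< ∏< : ℕ → (ℕ → ℤ) → ℤ
  ∑< = ∑.⨁
  ∏< = ∏.⨁

  ∏-neg : ∀ n f → ∏< n (λ k → - f k) ≡ -1ℤ ^ n * ∏< n f
  ∏-neg zero    f = refl
  ∏-neg (suc n) f rewrite ∏-neg n f = regroup (-1ℤ ^ n) (∏< n f) (f n)
    where
    regroup : ∀ s a b → s * a * - b ≡ -1ℤ * s * (a * b)
    regroup = solve-∀

  -1^[n+n]≡1 : ∀ n → -1ℤ ^ (n ℕ.+ n) ≡ 1ℤ
  -1^[n+n]≡1 zero    = refl
  -1^[n+n]≡1 (suc n) rewrite ℕ.+-suc n n | -1^[n+n]≡1 n = refl

  ∑-*ˡ : ∀ n c f → ∑< n (λ i → c * f i) ≡ c * ∑< n f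
  ∑-*ˡ zero    c f = sym (*-zeroʳ c)
  ∑-*ˡ (suc n) c f rewrite ∑-*ˡ n c f = sym (*-distribˡ-+ c _ _)

  ∑-*ʳ : ∀ n c f → ∑< n (λ i → f i * c) ≡ ∑< n f * c
  ∑-*ʳ n c f = begin
    ∑< n (λ i → f i * c) ≡⟨ ∑.⨁-cong n (λ i _ → *-comm (f i) c) ⟩
    ∑< n (λ i → c * f i) ≡⟨ ∑-*ˡ n c f ⟩
    c * ∑< n f           ≡⟨ *-comm c _ ⟩
    ∑< n f * c           ∎
    where open ≡-Reasoning

  ∑-const : ∀ n c → ∑< n (λ _ → c) ≡ + n * c
  ∑-const zero    c = refl
  ∑-const (suc n) c rewrite ∑-const n c = regroup (+ n) c
    where
    regroup : ∀ n c → n * c + c ≡ (1ℤ + n) * c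
    regroup = solve-∀

  ∑-≋ : ∀ n {m f g} → (∀ i → i < n → f i ≋ g i [mod m ]) → ∑< n f ≋ ∑< n g [mod m ]
  ∑-≋ zero    f≋g = ≋-refl
  ∑-≋ (suc n) f≋g = ≋-+ (∑-≋ n (λ i i<n → f≋g i (ℕ.m≤n⇒m≤1+n i<n))) (f≋g n ℕ.≤-refl)

  ∑-single : ∀ n {f} i₀ → i₀ < n → (∀ i → i < n → i ≢ i₀ → f i ≡ 0ℤ) → ∑< n f ≡ f i₀
  ∑-single (suc n) {f} i₀ i₀<1+n f≡0 with ℕ.m≤n⇒m<n∨m≡n (ℕ.≤-pred i₀<1+n)
  ... | inj₁ i₀<n = begin
    ∑< n f + f n ≡⟨ cong₂ _+_ (∑-single n i₀ i₀<n (λ i i<n → f≡0 i (ℕ.m≤n⇒m≤1+n i<n)))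
                              (f≡0 n ℕ.≤-refl (λ n≡i₀ → ℕ.<-irrefl (sym n≡i₀) i₀<n)) ⟩
    f i₀ + 0ℤ    ≡⟨ +-identityʳ (f i₀) ⟩
    f i₀         ∎
    where open ≡-Reasoning
  ... | inj₂ refl = trans (cong (_+ f n) (∑.⨁-ε n (λ i i<n → f≡0 i (ℕ.m≤n⇒m≤1+n i<n) (ℕ.<⇒≢ i<n)))) (+-identityˡ (f n))

  square : ℕ → ℤ
  square i = + i * + i

  6∑i²<n : ∀ n → + 6 * ∑< n square ≡ (+ n - 1ℤ) * + n * (+ 2 * + n - 1ℤ)
  6∑i²<n zero    = refl
  6∑i²<n (suc n) = begin
    + 6 * (∑< n square + + n * + n)                 ≡⟨ *-distribˡ-+ (+ 6) (∑< n square) (+ n * + n) ⟩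
    + 6 * ∑< n square + + 6 * (+ n * + n)           ≡⟨ cong (_+ + 6 * (+ n * + n)) (6∑i²<n n) ⟩
    (+ n - 1ℤ) * + n * (+ 2 * + n - 1ℤ) + + 6 * (+ n * + n) ≡⟨ step (+ n) ⟩
    + n * (1ℤ + + n) * (+ 2 * (1ℤ + + n) - 1ℤ)      ∎
    where
    open ≡-Reasoning
    step : ∀ n → (n - 1ℤ) * n * (+ 2 * n - 1ℤ) + + 6 * (n * n) ≡ n * (1ℤ + n) * (+ 2 * (1ℤ + n) - 1ℤ)
    step = solve-∀

  ∣∧<⇒≡0 : ∀ {q n} → q ℕ.∣ n → n < q → n ≡ 0
  ∣∧<⇒≡0 {n = zero}  _   _   = refl
  ∣∧<⇒≡0 {n = suc n} q∣n n<q = ⊥-elim (ℕ.<⇒≱ n<q (ℕ.∣⇒≤ q∣n))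

  ∣-difference-below : ∀ {q a b} → a < q → b < q → + q ∣ + a - + b → a ≡ b
  ∣-difference-below {q} {a} {b} a<q b<q q∣a-b =
    [ (λ b≤a → ordered b≤a a<q q∣a-b)
    , (λ a≤b → sym (ordered a≤b b<q (subst (+ q ∣_) (neg-minus (+ a) (+ b)) (∣m⇒∣-m q∣a-b))))
    ]′ (ℕ.≤-total b a)
    where
    neg-minus : ∀ a b → - (a - b) ≡ b - a
    neg-minus = solve-∀
    ordered : ∀ {a b} → b ≤ a → a < q → + q ∣ + a - + b → a ≡ b
    ordered {a} {b} b≤a a<q q∣a-b =
      ℕ.≤-antisym (ℕ.m∸n≡0⇒m≤n (∣∧<⇒≡0 q∣a∸b (ℕ.≤-<-trans (ℕ.m∸n≤m a b) a<q))) b≤a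
      where
      q∣a∸b : q ℕ.∣ a ∸ b
      q∣a∸b = ∣⇒∣ᵤ (subst (+ q ∣_) (trans (m-n≡m⊖n a b) (⊖-≥ b≤a)) q∣a-b)

  *-pres-∣ : ∀ {a b x y} → a ∣ x → b ∣ y → a * b ∣ x * y
  *-pres-∣ {a} {b} (divides q refl) (divides r refl) = divides (q * r) (regroup q a r b)
    where
    regroup : ∀ q a r b → q * a * (r * b) ≡ q * r * (a * b)
    regroup = solve-∀

  ^-pres-∣ : ∀ {a x} n → a ∣ x → a ^ n ∣ x ^ n
  ^-pres-∣ zero    _   = ∣-refl
  ^-pres-∣ (suc n) a∣x = *-pres-∣ a∣x (^-pres-∣ n a∣x)

  pos-^ : ∀ a n → + (a ℕ.^ n) ≡ (+ a) ^ n
  pos-^ a zero    = refl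
  pos-^ a (suc n) = trans (pos-* a (a ℕ.^ n)) (cong (+ a *_) (pos-^ a n))

  ^-distribʳ-* : ∀ a b n → (a * b) ^ n ≡ a ^ n * b ^ n
  ^-distribʳ-* a b zero    = refl
  ^-distribʳ-* a b (suc n) rewrite ^-distribʳ-* a b n = regroup a b (a ^ n) (b ^ n)
    where
    regroup : ∀ a b x y → a * b * (x * y) ≡ a * x * (b * y)
    regroup = solve-∀

  ^-scaled-difference : ∀ d x y X z w Z A B → d * x ≡ y * X → d * z ≡ w * Z →
    d ^ A * d ^ B * (x ^ A * z ^ B - y ^ A * w ^ B) ≡ y ^ A * w ^ B * (X ^ A * Z ^ B - d ^ A * d ^ B)
  ^-scaled-difference d x y X z w Z A B dx≡yX dz≡wZ = begin
    d ^ A * d ^ B * (x ^ A * z ^ B - y ^ A * w ^ B)                 ≡⟨ expand (d ^ A) (d ^ B) (x ^ A) (z ^ B) (y ^ A * w ^ B) ⟩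
    (d ^ A * x ^ A) * (d ^ B * z ^ B) - d ^ A * d ^ B * (y ^ A * w ^ B)
      ≡⟨ cong₂ (λ u v → u * v - d ^ A * d ^ B * (y ^ A * w ^ B)) (power A dx≡yX) (power B dz≡wZ) ⟩
    (y ^ A * X ^ A) * (w ^ B * Z ^ B) - d ^ A * d ^ B * (y ^ A * w ^ B) ≡⟨ collect (y ^ A) (X ^ A) (w ^ B) (Z ^ B) (d ^ A * d ^ B) ⟩
    y ^ A * w ^ B * (X ^ A * Z ^ B - d ^ A * d ^ B)                 ∎
    where
    open ≡-Reasoning
    power : ∀ {a b c e} n → a * b ≡ c * e → a ^ n * b ^ n ≡ c ^ n * e ^ n
    power {a} {b} {c} {e} n ab≡ce = trans (sym (^-distribʳ-* a b n)) (trans (cong (_^ n) ab≡ce) (^-distribʳ-* c e n))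
    expand : ∀ a b x z m → a * b * (x * z - m) ≡ (a * x) * (b * z) - a * b * m
    expand = solve-∀
    collect : ∀ y X w Z m → (y * X) * (w * Z) - m * (y * w) ≡ y * w * (X * Z - m)
    collect = solve-∀

  sumTo≡∑< : ∀ n f → + sumTo n f ≡ ∑< (suc n) (λ k → + f k)
  sumTo≡∑< zero    f = refl
  sumTo≡∑< (suc n) f = trans (pos-+ (sumTo n f) (f (suc n))) (cong (_+ + f (suc n)) (sumTo≡∑< n f))

  sumTo-≋ : ∀ n {M f g} → (∀ j → j ≤ n → + f j ≋ + g j [mod M ]) → + sumTo n f ≋ + sumTo n g [mod M ]
  sumTo-≋ n {M} {f} {g} f≋g = subst₂ (_≋_[mod M ]) (sym (sumTo≡∑< n f)) (sym (sumTo≡∑< n g))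
    (∑-≋ (suc n) (λ j j<1+n → f≋g j (ℕ.≤-pred j<1+n)))

  pos-^*^ : ∀ a b A B → + (a ℕ.^ A ℕ.* b ℕ.^ B) ≡ (+ a) ^ A * (+ b) ^ B
  pos-^*^ a b A B = trans (pos-* (a ℕ.^ A) (b ℕ.^ B)) (cong₂ _*_ (pos-^ a A) (pos-^ b B))

  DifferenceDivisible : (ℤ → ℤ) → Set
  DifferenceDivisible V = ∀ a b → (a - b) ∣ V a - V b

  linear-at-root : ∀ d s y v → y ≢ 0ℤ → d + y * s + y * y * v ≡ d → s ≡ - y * v
  linear-at-root d s y v y≢0 root = *-cancelˡ-≡ y s (- y * v) {{≢-nonZero y≢0}} (begin
    y * s                                 ≡⟨ isolate d y s v ⟩
    (d + y * s + y * y * v) - d - y * y * v ≡⟨ cong (λ z → z - d - y * y * v) root ⟩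
    d - d - y * y * v                     ≡⟨ collect d y v ⟩
    y * (- y * v)                         ∎)
    where
    open ≡-Reasoning
    isolate : ∀ d y s v → y * s ≡ d + y * s + y * y * v - d - y * y * v
    isolate = solve-∀
    collect : ∀ d y v → d - d - y * y * v ≡ y * (- y * v)
    collect = solve-∀

  cube∣-near-root : ∀ {t} (V : ℤ → ℤ) s x y → DifferenceDivisible V → s ≡ - y * V y →
                    t ∣ x → t ∣ y → t ∣ V 0ℤ → t * t * t ∣ x * s + x * x * V x
  cube∣-near-root {t} V s x y V-diff refl t∣x t∣y t∣V0 =
    subst (t * t * t ∣_) (sym factorised) (*-pres-∣ (*-pres-∣ t∣x (∣m∣n⇒∣m-n t∣x t∣y)) t∣last)
    where
    k₁ = quotient (V-diff x y)
    k₀ = quotient (V-diff x 0ℤ)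
    t∣last : t ∣ V 0ℤ + x * k₀ + y * k₁
    t∣last = ∣m∣n⇒∣m+n (∣m∣n⇒∣m+n t∣V0 (∣m⇒∣m*n k₀ t∣x)) (∣m⇒∣m*n k₁ t∣y)
    Vy≡ : V y ≡ V x - k₁ * (x - y)
    Vy≡ = trans (sub-sub (V x) (V y)) (cong (λ z → V x - z) (_∣_.equality (V-diff x y)))
      where
      sub-sub : ∀ a b → b ≡ a - (a - b)
      sub-sub = solve-∀
    Vx≡ : V x ≡ V 0ℤ + k₀ * x
    Vx≡ = trans (add-sub (V x) (V 0ℤ)) (cong (λ z → V 0ℤ + z) (trans (_∣_.equality (V-diff x 0ℤ)) (cong (k₀ *_) (+-identityʳ x))))
      where
      add-sub : ∀ a b → a ≡ b + (a - b)
      add-sub = solve-∀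
    expand : ∀ x y v₀ k₀ k₁ →
      x * (- y * (v₀ + k₀ * x - k₁ * (x - y))) + x * x * (v₀ + k₀ * x) ≡ x * (x - y) * (v₀ + x * k₀ + y * k₁)
    expand = solve-∀
    factorised : x * (- y * V y) + x * x * V x ≡ x * (x - y) * (V 0ℤ + x * k₀ + y * k₁)
    factorised = begin
      x * (- y * V y) + x * x * V x                          ≡⟨ cong (λ b → x * (- y * b) + x * x * V x) Vy≡ ⟩
      x * (- y * (V x - k₁ * (x - y))) + x * x * V x         ≡⟨ cong (λ a → x * (- y * (a - k₁ * (x - y))) + x * x * a) Vx≡ ⟩
      x * (- y * (V 0ℤ + k₀ * x - k₁ * (x - y))) + x * x * (V 0ℤ + k₀ * x) ≡⟨ expand x y (V 0ℤ) k₀ k₁ ⟩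
      x * (x - y) * (V 0ℤ + x * k₀ + y * k₁)                 ∎
      where open ≡-Reasoning

  indicator : {A : Set} → Dec A → ℤ
  indicator (yes _) = 1ℤ
  indicator (no  _) = 0ℤ

  indicator-⇔ : ∀ {A B : Set} (a? : Dec A) (b? : Dec B) → (A → B) → (B → A) → indicator a? ≡ indicator b?
  indicator-⇔ (yes _) (yes _) _   _   = refl
  indicator-⇔ (yes a) (no ¬b) a⇒b _   = ⊥-elim (¬b (a⇒b a))
  indicator-⇔ (no ¬a) (yes b) _   b⇒a = ⊥-elim (¬a (b⇒a b))
  indicator-⇔ (no _)  (no _)  _   _   = refl

  indicator-yes : ∀ {A : Set} (a? : Dec A) → A → indicator a? ≡ 1ℤ
  indicator-yes (yes _) _ = refl
  indicator-yes (no ¬a) a = ⊥-elim (¬a a)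

  indicator-no : ∀ {A : Set} (a? : Dec A) → ¬ A → indicator a? ≡ 0ℤ
  indicator-no (yes a) ¬a = ⊥-elim (¬a a)
  indicator-no (no _)  _  = refl

  -- Binomial coefficients

  [k+l]Ck*k!*l!≡[k+l]! : ∀ k l → ((k ℕ.+ l) C k) ℕ.* (k ! ℕ.* l !) ≡ (k ℕ.+ l) !
  [k+l]Ck*k!*l!≡[k+l]! k l = begin
    ((k ℕ.+ l) C k) ℕ.* (k ! ℕ.* l !)                                   ≡⟨ cong (ℕ._* (k ! ℕ.* l !)) (nCk≡n!/k![n-k]! k≤k+l) ⟩
    ((k ℕ.+ l) ! ℕ./ (k ! ℕ.* (k ℕ.+ l ∸ k) !)) {{ℕ._!*_!≢0 k (k ℕ.+ l ∸ k)}} ℕ.* (k ! ℕ.* l !)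
      ≡⟨ cong (λ m → ((k ℕ.+ l) ! ℕ./ (k ! ℕ.* m !)) {{ℕ._!*_!≢0 k m}} ℕ.* (k ! ℕ.* l !)) (ℕ.m+n∸m≡n k l) ⟩
    ((k ℕ.+ l) ! ℕ./ (k ! ℕ.* l !)) {{ℕ._!*_!≢0 k l}} ℕ.* (k ! ℕ.* l !) ≡⟨ ℕ.m/n*n≡m {{ℕ._!*_!≢0 k l}} k!l!∣[k+l]! ⟩
    (k ℕ.+ l) !                                                         ∎
    where
    open ≡-Reasoning
    k≤k+l = ℕ.m≤m+n k l
    k!l!∣[k+l]! : k ! ℕ.* l ! ℕ.∣ (k ℕ.+ l) !
    k!l!∣[k+l]! = subst (λ m → k ! ℕ.* m ! ℕ.∣ (k ℕ.+ l) !) (ℕ.m+n∸m≡n k l) (k![n∸k]!∣n! k≤k+l)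

  absorption : ∀ n k .{{_ : ℕ.NonZero k}} → k ℕ.* (n C k) ≡ n ℕ.* (ℕ.pred n C ℕ.pred k)
  absorption zero    (suc k) = trans (cong (suc k ℕ.*_) (k>n⇒nCk≡0 {0} {suc k} (s≤s z≤n))) (ℕ.*-zeroʳ (suc k))
  absorption (suc n) (suc k) with ℕ.≤-<-connex k n
  ... | inj₂ n<k = begin
    suc k ℕ.* (suc n C suc k) ≡⟨ cong (suc k ℕ.*_) (k>n⇒nCk≡0 (s≤s n<k)) ⟩
    suc k ℕ.* 0               ≡⟨ ℕ.*-zeroʳ (suc k) ⟩
    0                         ≡⟨ ℕ.*-zeroʳ (suc n) ⟨
    suc n ℕ.* 0               ≡⟨ cong (suc n ℕ.*_) (k>n⇒nCk≡0 n<k) ⟨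
    suc n ℕ.* (n C k)         ∎
    where open ≡-Reasoning
  ... | inj₁ k≤n = ℕ.*-cancelʳ-≡ _ _ (k ! ℕ.* l !) {{ℕ._!*_!≢0 k l}} (begin
    suc k ℕ.* (suc n C suc k) ℕ.* (k ! ℕ.* l !)  ≡⟨ regroup (suc k) (suc n C suc k) (k !) (l !) ⟩
    (suc n C suc k) ℕ.* (suc k ! ℕ.* l !)        ≡⟨ cong (λ m → (suc m C suc k) ℕ.* (suc k ! ℕ.* l !)) k+l≡n ⟨
    ((suc k ℕ.+ l) C suc k) ℕ.* (suc k ! ℕ.* l !) ≡⟨ [k+l]Ck*k!*l!≡[k+l]! (suc k) l ⟩
    (suc k ℕ.+ l) !                              ≡⟨ cong (λ m → suc m !) k+l≡n ⟩
    suc n ℕ.* n !                                ≡⟨ cong (λ m → suc n ℕ.* m !) k+l≡n ⟨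
    suc n ℕ.* (k ℕ.+ l) !                        ≡⟨ cong (suc n ℕ.*_) ([k+l]Ck*k!*l!≡[k+l]! k l) ⟨
    suc n ℕ.* (((k ℕ.+ l) C k) ℕ.* (k ! ℕ.* l !)) ≡⟨ cong (λ m → suc n ℕ.* ((m C k) ℕ.* (k ! ℕ.* l !))) k+l≡n ⟩
    suc n ℕ.* ((n C k) ℕ.* (k ! ℕ.* l !))        ≡⟨ ℕ.*-assoc (suc n) (n C k) _ ⟨
    suc n ℕ.* (n C k) ℕ.* (k ! ℕ.* l !)          ∎)
    where
    open ≡-Reasoning
    l = n ∸ k
    k+l≡n : k ℕ.+ l ≡ n
    k+l≡n = ℕ.m+[n∸m]≡n k≤n
    regroup : ∀ a b x y → a ℕ.* b ℕ.* (x ℕ.* y) ≡ b ℕ.* (a ℕ.* x ℕ.* y)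
    regroup = ℕ.solve-∀

  -- With i ranging over the units i < N (p ∤ i): P N x = ∏ (x + i), D N = P N 0, W N i = D N / i and
  -- Q N = Σ (D N / i)²; S₁ N and V N x are the coefficients in P N x = D N + x S₁ N + x² V N x.
  module UnitProduct (p : ℕ) where

    unitFactor : ℤ → ℕ → ℤ
    unitFactor x i with p ∣? i
    ... | yes _ = 1ℤ
    ... | no  _ = x + + i

    P : ℕ → ℤ → ℤ
    P N x = ∏< N (unitFactor x)

    D : ℕ → ℤ
    D N = P N 0ℤ

    S₁ : ℕ → ℤ
    S₁ zero = 0ℤ
    S₁ (suc N) with p ∣? N
    ... | yes _ = S₁ N
    ... | no  _ = D N + + N * S₁ N

    V : ℕ → ℤ → ℤ
    V zero    x = 0ℤ
    V (suc N) x with p ∣? N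
    ... | yes _ = V N x
    ... | no  _ = S₁ N + (+ N + x) * V N x

    Q : ℕ → ℤ
    Q zero = 0ℤ
    Q (suc N) with p ∣? N
    ... | yes _ = Q N
    ... | no  _ = D N * D N + + N * + N * Q N

    onUnits : (ℕ → ℤ) → ℕ → ℤ
    onUnits f i with p ∣? i
    ... | yes _ = 0ℤ
    ... | no  _ = f i

    cofactor : ℕ → ℕ → ℤ
    cofactor i j with p ∣? j
    ... | yes _ = 1ℤ
    ... | no  _ with j ℕ.≟ i
    ...   | yes _ = 1ℤ
    ...   | no  _ = + j

    W : ℕ → ℕ → ℤ
    W N i = ∏< N (cofactor i)

    W² : ℕ → ℕ → ℤ
    W² N i = W N i * W N i

    unitFactor-p∣ : ∀ {x i} → p ℕ.∣ i → unitFactor x i ≡ 1ℤ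
    unitFactor-p∣ {x} {i} p∣i with p ∣? i
    ... | yes _   = refl
    ... | no  p∤i = ⊥-elim (p∤i p∣i)

    unitFactor-p∤ : ∀ {x i} → ¬ p ℕ.∣ i → unitFactor x i ≡ x + + i
    unitFactor-p∤ {x} {i} p∤i with p ∣? i
    ... | yes p∣i = ⊥-elim (p∤i p∣i)
    ... | no  _   = refl

    D-suc-p∣ : ∀ {N} → p ℕ.∣ N → D (suc N) ≡ D N
    D-suc-p∣ {N} p∣N = trans (cong (D N *_) (unitFactor-p∣ p∣N)) (*-identityʳ (D N))

    D-suc-p∤ : ∀ {N} → ¬ p ℕ.∣ N → D (suc N) ≡ D N * + N
    D-suc-p∤ {N} p∤N = cong (D N *_) (unitFactor-p∤ p∤N)

    onUnits-p∣ : ∀ {f i} → p ℕ.∣ i → onUnits f i ≡ 0ℤ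
    onUnits-p∣ {f} {i} p∣i with p ∣? i
    ... | yes _   = refl
    ... | no  p∤i = ⊥-elim (p∤i p∣i)

    onUnits-p∤ : ∀ {f i} → ¬ p ℕ.∣ i → onUnits f i ≡ f i
    onUnits-p∤ {f} {i} p∤i with p ∣? i
    ... | yes p∣i = ⊥-elim (p∤i p∣i)
    ... | no  _   = refl

    onUnits-cong : ∀ {f g} i → f i ≡ g i → onUnits f i ≡ onUnits g i
    onUnits-cong i fi≡gi with p ∣? i
    ... | yes _ = refl
    ... | no  _ = fi≡gi

    onUnits-*ˡ : ∀ c f i → onUnits (λ j → c * f j) i ≡ c * onUnits f i
    onUnits-*ˡ c f i with p ∣? i
    ... | yes _ = sym (*-zeroʳ c)
    ... | no  _ = refl

    Q-suc-p∣ : ∀ {N} → p ℕ.∣ N → Q (suc N) ≡ Q N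
    Q-suc-p∣ {N} p∣N with p ∣? N
    ... | yes _   = refl
    ... | no  p∤N = ⊥-elim (p∤N p∣N)

    Q-suc-p∤ : ∀ {N} → ¬ p ℕ.∣ N → Q (suc N) ≡ D N * D N + + N * + N * Q N
    Q-suc-p∤ {N} p∤N with p ∣? N
    ... | yes p∣N = ⊥-elim (p∤N p∣N)
    ... | no  _   = refl

    W≡D : ∀ N i → N ≤ i → W N i ≡ D N
    W≡D zero    i _   = refl
    W≡D (suc N) i N<i with p ∣? N
    ... | yes _ = cong (_* 1ℤ) (W≡D N i (ℕ.<⇒≤ N<i))
    ... | no  _ with N ℕ.≟ i
    ...   | yes refl = ⊥-elim (ℕ.<-irrefl refl N<i)
    ...   | no  _    = cong (_* + N) (W≡D N i (ℕ.<⇒≤ N<i))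

    W-suc-p∣ : ∀ {N i} → p ℕ.∣ N → W (suc N) i ≡ W N i
    W-suc-p∣ {N} {i} p∣N with p ∣? N
    ... | yes _   = *-identityʳ (W N i)
    ... | no  p∤N = ⊥-elim (p∤N p∣N)

    W-suc-p∤ : ∀ {N i} → ¬ p ℕ.∣ N → N ≢ i → W (suc N) i ≡ W N i * + N
    W-suc-p∤ {N} {i} p∤N N≢i with p ∣? N
    ... | yes p∣N = ⊥-elim (p∤N p∣N)
    ... | no  _ with N ℕ.≟ i
    ...   | yes N≡i = ⊥-elim (N≢i N≡i)
    ...   | no  _   = refl

    W-suc-self : ∀ {N} → ¬ p ℕ.∣ N → W (suc N) N ≡ D N
    W-suc-self {N} p∤N with p ∣? N
    ... | yes p∣N = ⊥-elim (p∤N p∣N)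
    ... | no  _ with N ℕ.≟ N
    ...   | yes _   = trans (*-identityʳ (W N N)) (W≡D N N ℕ.≤-refl)
    ...   | no  N≢N = ⊥-elim (N≢N refl)

    W*i≡D : ∀ N i → i < N → ¬ p ℕ.∣ i → W N i * + i ≡ D N
    W*i≡D (suc N) i i<1+N p∤i with ℕ.m≤n⇒m<n∨m≡n (ℕ.≤-pred i<1+N)
    ... | inj₂ refl = trans (cong (_* + N) (W-suc-self p∤i)) (sym (D-suc-p∤ p∤i))
    ... | inj₁ i<N  = case p ∣? N of λ where
      (yes p∣N) → begin
        W (suc N) i * + i ≡⟨ cong (_* + i) (W-suc-p∣ p∣N) ⟩
        W N i * + i       ≡⟨ W*i≡D N i i<N p∤i ⟩
        D N               ≡⟨ D-suc-p∣ p∣N ⟨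
        D (suc N)         ∎
      (no  p∤N) → begin
        W (suc N) i * + i ≡⟨ cong (_* + i) (W-suc-p∤ p∤N (ℕ.>⇒≢ i<N)) ⟩
        W N i * + N * + i ≡⟨ xy∙z≈xz∙y (W N i) (+ N) (+ i) ⟩
        W N i * + i * + N ≡⟨ cong (_* + N) (W*i≡D N i i<N p∤i) ⟩
        D N * + N         ≡⟨ D-suc-p∤ p∤N ⟨
        D (suc N)         ∎
     where open ≡-Reasoning

    P-expansion : ∀ N x → P N x ≡ D N + x * S₁ N + x * x * V N x
    P-expansion zero    x = expand x
      where
      expand : ∀ x → 1ℤ ≡ 1ℤ + x * 0ℤ + x * x * 0ℤ
      expand = solve-∀
    P-expansion (suc N) x with p ∣? N
    ... | yes _ rewrite P-expansion N x = expand (D N) x (S₁ N) (V N x)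
      where
      expand : ∀ d x s v → (d + x * s + x * x * v) * 1ℤ ≡ d * 1ℤ + x * s + x * x * v
      expand = solve-∀
    ... | no  _ rewrite P-expansion N x = expand (D N) x (S₁ N) (V N x) (+ N)
      where
      expand : ∀ d x s v n → (d + x * s + x * x * v) * (x + n) ≡ d * (0ℤ + n) + x * (d + n * s) + x * x * (s + (n + x) * v)
      expand = solve-∀

    V-diff : ∀ N → DifferenceDivisible (V N)
    V-diff zero    x y = divides 0ℤ refl
    V-diff (suc N) x y with p ∣? N
    ... | yes _ = V-diff N x y
    ... | no  _ with V-diff N x y
    ...   | divides q eq = divides ((+ N + x) * q + V N y) (begin
      S₁ N + (+ N + x) * V N x - (S₁ N + (+ N + y) * V N y) ≡⟨ split (S₁ N) (+ N) x y (V N x) (V N y) ⟩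
      (+ N + x) * (V N x - V N y) + (x - y) * V N y         ≡⟨ cong (λ z → (+ N + x) * z + (x - y) * V N y) eq ⟩
      (+ N + x) * (q * (x - y)) + (x - y) * V N y           ≡⟨ collect (+ N) x y q (V N y) ⟩
      ((+ N + x) * q + V N y) * (x - y)                     ∎)
      where
      open ≡-Reasoning
      split : ∀ s n x y a b → s + (n + x) * a - (s + (n + y) * b) ≡ (n + x) * (a - b) + (x - y) * b
      split = solve-∀
      collect : ∀ n x y q b → (n + x) * (q * (x - y)) + (x - y) * b ≡ ((n + x) * q + b) * (x - y)
      collect = solve-∀

    2DV≡S₁²-Q : ∀ N → + 2 * D N * V N 0ℤ ≡ S₁ N * S₁ N - Q N
    2DV≡S₁²-Q zero = refl
    2DV≡S₁²-Q (suc N) with p ∣? N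
    ... | yes _ = trans (drop-1 (D N) (V N 0ℤ)) (2DV≡S₁²-Q N)
      where
      drop-1 : ∀ d v → + 2 * (d * 1ℤ) * v ≡ + 2 * d * v
      drop-1 = solve-∀
    ... | no  _ = begin
      + 2 * (D N * (0ℤ + + N)) * (S₁ N + (+ N + 0ℤ) * V N 0ℤ)     ≡⟨ expand (D N) (+ N) (S₁ N) (V N 0ℤ) ⟩
      (+ 2 * D N * V N 0ℤ) * (+ N * + N) + + 2 * D N * S₁ N * + N
        ≡⟨ cong (λ z → z * (+ N * + N) + + 2 * D N * S₁ N * + N) (2DV≡S₁²-Q N) ⟩
      (S₁ N * S₁ N - Q N) * (+ N * + N) + + 2 * D N * S₁ N * + N   ≡⟨ collect (D N) (+ N) (S₁ N) (Q N) ⟩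
      (D N + + N * S₁ N) * (D N + + N * S₁ N) - (D N * D N + + N * + N * Q N) ∎
      where
      open ≡-Reasoning
      expand : ∀ d n s v → + 2 * (d * (0ℤ + n)) * (s + (n + 0ℤ) * v) ≡ (+ 2 * d * v) * (n * n) + + 2 * d * s * n
      expand = solve-∀
      collect : ∀ d n s q → (s * s - q) * (n * n) + + 2 * d * s * n ≡ (d + n * s) * (d + n * s) - (d * d + n * n * q)
      collect = solve-∀

    ∑W²-suc-p∣ : ∀ {N} → p ℕ.∣ N → ∑< (suc N) (onUnits (W² (suc N))) ≡ ∑< N (onUnits (W² N))
    ∑W²-suc-p∣ {N} p∣N = begin
      ∑< N (onUnits (W² (suc N))) + onUnits (W² (suc N)) N ≡⟨ cong (λ u → ∑< N (onUnits (W² (suc N))) + u) (onUnits-p∣ p∣N) ⟩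
      ∑< N (onUnits (W² (suc N))) + 0ℤ                     ≡⟨ +-identityʳ _ ⟩
      ∑< N (onUnits (W² (suc N)))
        ≡⟨ ∑.⨁-cong N (λ i _ → onUnits-cong i (cong (λ w → w * w) (W-suc-p∣ p∣N))) ⟩
      ∑< N (onUnits (W² N))                                ∎
      where open ≡-Reasoning

    ∑W²-suc-p∤ : ∀ {N} → ¬ p ℕ.∣ N → ∑< (suc N) (onUnits (W² (suc N))) ≡ D N * D N + + N * + N * ∑< N (onUnits (W² N))
    ∑W²-suc-p∤ {N} p∤N = begin
      ∑< N (onUnits (W² (suc N))) + onUnits (W² (suc N)) N            ≡⟨ cong₂ _+_ (∑.⨁-cong N (λ i i<N → scaled i i<N)) last ⟩
      ∑< N (λ i → + N * + N * onUnits (W² N) i) + D N * D N            ≡⟨ +-comm _ (D N * D N) ⟩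
      D N * D N + ∑< N (λ i → + N * + N * onUnits (W² N) i)
        ≡⟨ cong (λ u → D N * D N + u) (∑-*ˡ N (+ N * + N) (onUnits (W² N))) ⟩
      D N * D N + + N * + N * ∑< N (onUnits (W² N))                    ∎
      where
      open ≡-Reasoning
      square-product : ∀ w n → (w * n) * (w * n) ≡ n * n * (w * w)
      square-product = solve-∀
      last : onUnits (W² (suc N)) N ≡ D N * D N
      last = trans (onUnits-p∤ p∤N) (cong (λ w → w * w) (W-suc-self p∤N))
      scaled : ∀ i → i < N → onUnits (W² (suc N)) i ≡ + N * + N * onUnits (W² N) i
      scaled i i<N = trans (onUnits-cong i (trans (cong (λ w → w * w) (W-suc-p∤ p∤N (ℕ.>⇒≢ i<N))) (square-product (W N i) (+ N))))
                           (onUnits-*ˡ (+ N * + N) (W² N) i)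

    Q≡∑W² : ∀ N → Q N ≡ ∑< N (onUnits (W² N))
    Q≡∑W² zero    = refl
    Q≡∑W² (suc N) = case p ∣? N of λ where
      (yes p∣N) → trans (Q-suc-p∣ p∣N) (trans (Q≡∑W² N) (sym (∑W²-suc-p∣ p∣N)))
      (no  p∤N) → trans (Q-suc-p∤ p∤N) (trans (cong (λ q → D N * D N + + N * + N * q) (Q≡∑W² N)) (sym (∑W²-suc-p∤ p∤N)))

  -- Prime powers, valuations and inverses

  module _ {p : ℕ} (p-prime : Prime p) where

    open UnitProduct p

    instance
      p≢0 : ℕ.NonZero p
      p≢0 = prime⇒nonZero p-prime

    p^≢0 : ∀ k → ℕ.NonZero (p ℕ.^ k)
    p^≢0 k = ℕ.m^n≢0 p k

    p∤1 : ¬ p ℕ.∣ 1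
    p∤1 p∣1 = ℕ.<⇒≢ (ℕ.nonTrivial⇒n>1 p {{prime⇒nonTrivial p-prime}}) (sym (ℕ.∣1⇒≡1 p∣1))

    p∤* : ∀ {m n} → ¬ p ℕ.∣ m → ¬ p ℕ.∣ n → ¬ p ℕ.∣ m ℕ.* n
    p∤* {m} {n} p∤m p∤n p∣mn with euclidsLemma m n p-prime p∣mn
    ... | inj₁ p∣m = p∤m p∣m
    ... | inj₂ p∣n = p∤n p∣n

    p∤6⇒p∤2 : ¬ p ℕ.∣ 6 → ¬ p ℕ.∣ 2
    p∤6⇒p∤2 p∤6 p∣2 = p∤6 (ℕ.∣-trans p∣2 (divides 3 refl))

    coprime-p^ : ∀ k {n} → ¬ p ℕ.∣ n → Coprime n (p ℕ.^ k)
    coprime-p^ zero    p∤n (_ , d∣1) = ℕ.∣1⇒≡1 d∣1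
    coprime-p^ (suc k) {n} p∤n {d} (d∣n , d∣p^1+k) =
      coprime-p^ k p∤n (d∣n , coprime-divisor coprime-d-p d∣p^1+k)
      where
      coprime-d-p : Coprime d p
      coprime-d-p {e} (e∣d , e∣p) with prime⇒irreducible p-prime e∣p
      ... | inj₁ e≡1    = e≡1
      ... | inj₂ refl   = ⊥-elim (p∤n (ℕ.∣-trans e∣d d∣n))

    p^∣-cancelˡ : ∀ k {n m} → ¬ p ℕ.∣ n → p ℕ.^ k ℕ.∣ n ℕ.* m → p ℕ.^ k ℕ.∣ m
    p^∣-cancelˡ k p∤n = coprime-divisor (Coprimality.sym (coprime-p^ k p∤n))

    p^-mono-∣ : ∀ {m n} → m ≤ n → p ℕ.^ m ℕ.∣ p ℕ.^ n
    p^-mono-∣ {m} {n} m≤n = divides (p ℕ.^ (n ∸ m)) (begin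
      p ℕ.^ n                       ≡⟨ cong (p ℕ.^_) (ℕ.m+[n∸m]≡n m≤n) ⟨
      p ℕ.^ (m ℕ.+ (n ∸ m))         ≡⟨ ℕ.^-distribˡ-+-* p m (n ∸ m) ⟩
      p ℕ.^ m ℕ.* p ℕ.^ (n ∸ m)     ≡⟨ ℕ.*-comm (p ℕ.^ m) _ ⟩
      p ℕ.^ (n ∸ m) ℕ.* p ℕ.^ m     ∎)
      where open ≡-Reasoning

    HasValuation : ℕ → ℕ → Set
    HasValuation j s = ∃ λ j′ → j ≡ p ℕ.^ s ℕ.* j′ × ¬ p ℕ.∣ j′

    valuation-split : ∀ k j → p ℕ.^ k ℕ.∣ j ⊎ ∃ λ s → s < k × HasValuation j s
    valuation-split zero    j = inj₁ (ℕ.1∣ j)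
    valuation-split (suc k) j with valuation-split k j
    ... | inj₂ (s , s<k , v) = inj₂ (s , ℕ.m≤n⇒m≤1+n s<k , v)
    ... | inj₁ (divides q j≡q*p^k) with p ∣? q
    ...   | yes (divides q′ refl) = inj₁ (divides q′ (trans j≡q*p^k (ℕ.*-assoc q′ p (p ℕ.^ k))))
    ...   | no  p∤q               = inj₂ (k , ℕ.≤-refl , q , trans j≡q*p^k (ℕ.*-comm q (p ℕ.^ k)) , p∤q)

    n<p^n : ∀ n → n < p ℕ.^ n
    n<p^n zero    = s≤s z≤n
    n<p^n (suc n) = begin-strict
      suc n               <⟨ s≤s (n<p^n n) ⟩
      1 ℕ.+ p ℕ.^ n       ≤⟨ ℕ.+-monoˡ-≤ (p ℕ.^ n) (ℕ.m^n>0 p n) ⟩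
      p ℕ.^ n ℕ.+ p ℕ.^ n ≡⟨ cong (p ℕ.^ n ℕ.+_) (ℕ.+-identityʳ (p ℕ.^ n)) ⟨
      2 ℕ.* p ℕ.^ n       ≤⟨ ℕ.*-monoˡ-≤ (p ℕ.^ n) (ℕ.nonTrivial⇒n>1 p {{prime⇒nonTrivial p-prime}}) ⟩
      p ℕ.* p ℕ.^ n       ∎
      where open ℕ.≤-Reasoning

    valuation : ∀ j → .{{ℕ.NonZero j}} → ∃ (HasValuation j)
    valuation j with valuation-split j j
    ... | inj₁ p^j∣j     = ⊥-elim (ℕ.<⇒≱ (n<p^n j) (ℕ.∣⇒≤ p^j∣j))
    ... | inj₂ (s , _ , v) = s , v

    record Unit (d : ℤ) : Set where
      constructor unit
      field p∤∣d∣ : ¬ p ℕ.∣ ∣ d ∣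

    Unit-* : ∀ {a b} → Unit a → Unit b → Unit (a * b)
    Unit-* {a} {b} (unit p∤a) (unit p∤b) = unit (λ p∣ab → p∤* p∤a p∤b (subst (p ℕ.∣_) (abs-* a b) p∣ab))

    Unit-^ : ∀ {a} n → Unit a → Unit (a ^ n)
    Unit-^ zero    _      = unit p∤1
    Unit-^ (suc n) a-unit = Unit-* a-unit (Unit-^ n a-unit)

    Unit⇒NonZero : ∀ {d} → Unit d → NonZero d
    Unit⇒NonZero {d} (unit p∤d) = ℕ.≢-nonZero (λ ∣d∣≡0 → p∤d (subst (p ℕ.∣_) (sym ∣d∣≡0) (ℕ._∣0 p)))

    p^∣ℤ-cancelˡ : ∀ k {d t} → Unit d → + (p ℕ.^ k) ∣ d * t → + (p ℕ.^ k) ∣ t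
    p^∣ℤ-cancelˡ k {d} {t} (unit p∤d) p^k∣dt =
      ∣ᵤ⇒∣ (p^∣-cancelˡ k p∤d (subst (p ℕ.^ k ℕ.∣_) (abs-* d t) (∣⇒∣ᵤ p^k∣dt)))

    D-Unit : ∀ N → Unit (D N)
    D-Unit zero    = unit p∤1
    D-Unit (suc N) = Unit-* (D-Unit N) (case p ∣? N of λ where
      (yes p∣N) → subst Unit (sym (unitFactor-p∣ p∣N)) (unit p∤1)
      (no  p∤N) → subst Unit (sym (unitFactor-p∤ p∤N)) (unit p∤N))

    p≡1+pred-p : p ≡ suc (ℕ.pred p)
    p≡1+pred-p = sym (ℕ.suc-pred p)

    block-head : ∀ t → p ℕ.∣ t ℕ.* p ℕ.+ 0
    block-head t = subst (p ℕ.∣_) (sym (ℕ.+-identityʳ (t ℕ.* p))) (n∣m*n t)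

    block-interior : ∀ t {k} → k < ℕ.pred p → ¬ p ℕ.∣ t ℕ.* p ℕ.+ suc k
    block-interior t {k} k<p-1 p∣ =
      ℕ.<⇒≱ (subst (suc k <_) (sym p≡1+pred-p) (s≤s k<p-1)) (ℕ.∣⇒≤ (ℕ.∣m+n∣m⇒∣n p∣ (n∣m*n t)))

    ∏-block : ∀ (f : ℕ → ℤ) t →
      ∏< p (λ k → f (t ℕ.* p ℕ.+ k)) ≡ f (t ℕ.* p ℕ.+ 0) * ∏< (ℕ.pred p) (λ k → f (t ℕ.* p ℕ.+ suc k))
    ∏-block f t = trans (cong (λ n → ∏< n (λ k → f (t ℕ.* p ℕ.+ k))) p≡1+pred-p)
                        (∏.⨁-suc (ℕ.pred p) (λ k → f (t ℕ.* p ℕ.+ k)))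

    ∑-block : ∀ (f : ℕ → ℤ) t →
      ∑< p (λ k → f (t ℕ.* p ℕ.+ k)) ≡ f (t ℕ.* p ℕ.+ 0) + ∑< (ℕ.pred p) (λ k → f (t ℕ.* p ℕ.+ suc k))
    ∑-block f t = trans (cong (λ n → ∑< n (λ k → f (t ℕ.* p ℕ.+ k))) p≡1+pred-p)
                        (∑.⨁-suc (ℕ.pred p) (λ k → f (t ℕ.* p ℕ.+ k)))

    block-interior-product : ℕ → ℤ
    block-interior-product t = ∏< (ℕ.pred p) (λ k → + (t ℕ.* p ℕ.+ suc k))

    D-block : ∀ t → ∏< p (λ k → unitFactor 0ℤ (t ℕ.* p ℕ.+ k)) ≡ block-interior-product t
    D-block t = begin
      ∏< p (λ k → unitFactor 0ℤ (t ℕ.* p ℕ.+ k))   ≡⟨ ∏-block (unitFactor 0ℤ) t ⟩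
      unitFactor 0ℤ (t ℕ.* p ℕ.+ 0) * ∏< (ℕ.pred p) (λ k → unitFactor 0ℤ (t ℕ.* p ℕ.+ suc k))
        ≡⟨ cong₂ _*_ (unitFactor-p∣ (block-head t)) (∏.⨁-cong (ℕ.pred p) (λ k k< → unitFactor-p∤ (block-interior t k<))) ⟩
      1ℤ * block-interior-product t                 ≡⟨ *-identityˡ _ ⟩
      block-interior-product t                      ∎
      where open ≡-Reasoning

    Inverse : ℕ → ℕ → ℕ → Set
    Inverse q i j = + q ∣ + i * + j - 1ℤ

    δ : ℕ → ℕ → ℕ → ℤ
    δ q i j = indicator (+ q ∣ℤ? (+ i * + j - 1ℤ))

    δ-sym : ∀ q i j → δ q i j ≡ δ q j i
    δ-sym q i j = cong (λ ij → indicator (+ q ∣ℤ? (ij - 1ℤ))) (*-comm (+ i) (+ j))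

    δ-periodic : ∀ q i t k → δ q i (t ℕ.* q ℕ.+ k) ≡ δ q i k
    δ-periodic q i t k = indicator-⇔ (+ q ∣ℤ? _) (+ q ∣ℤ? _)
      (λ q∣shifted → ∣m+n∣n⇒∣m (subst (+ q ∣_) shifted≡ q∣shifted) q∣iqt)
      (λ q∣ik-1 → subst (+ q ∣_) (sym shifted≡) (∣m∣n⇒∣m+n q∣ik-1 q∣iqt))
      where
      q∣iqt : + q ∣ + i * + t * + q
      q∣iqt = ∣n⇒∣m*n (+ i * + t) ∣-refl
      shift : ∀ i k t q → i * (t * q + k) - 1ℤ ≡ i * k - 1ℤ + i * t * q
      shift = solve-∀
      shifted≡ : + i * + (t ℕ.* q ℕ.+ k) - 1ℤ ≡ + i * + k - 1ℤ + + i * + t * + q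
      shifted≡ = trans (cong (λ z → + i * z - 1ℤ) (trans (pos-+ (t ℕ.* q) k) (cong (_+ + k) (pos-* t q))))
                       (shift (+ i) (+ k) (+ t) (+ q))

    Inverse-reduce : ∀ q i k → .{{_ : ℕ.NonZero q}} → + q ∣ + i * k - 1ℤ → Inverse q i (k %ℕ q)
    Inverse-reduce q i k q∣ik-1 = subst (+ q ∣_) reduce (∣m∣n⇒∣m-n q∣ik-1 (∣n⇒∣m*n (+ i * (k /ℕ q)) ∣-refl))
      where
      remove : ∀ i r t q → i * (r + t * q) - 1ℤ - i * t * q ≡ i * r - 1ℤ
      remove = solve-∀
      reduce : + i * k - 1ℤ - + i * (k /ℕ q) * + q ≡ + i * + (k %ℕ q) - 1ℤ
      reduce = trans (cong (λ z → + i * z - 1ℤ - + i * (k /ℕ q) * + q) (a≡a%ℕn+[a/ℕn]*n k q))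
                     (remove (+ i) (+ (k %ℕ q)) (k /ℕ q) (+ q))

    inverse-exists : ∀ e {i} → ¬ p ℕ.∣ i → ∃ λ k → k < p ℕ.^ e × Inverse (p ℕ.^ e) i k
    inverse-exists e {i} p∤i = from-Bézout (Coprimality.coprime-Bézout (coprime-p^ e p∤i))
      where
      q = p ℕ.^ e
      instance
        q≢0 : ℕ.NonZero q
        q≢0 = p^≢0 e
      from-integer : ∀ k → + q ∣ + i * k - 1ℤ → ∃ λ k → k < q × Inverse q i k
      from-integer k q∣ik-1 = k %ℕ q , n%ℕd<d k q , Inverse-reduce q i k q∣ik-1
      from-Bézout : Bézout.Identity 1 i q → ∃ λ k → k < q × Inverse q i k
      from-Bézout (Bézout.+- x y 1+yq≡xi) = from-integer (+ x) (divides (+ y) (begin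
        + i * + x - 1ℤ         ≡⟨ cong (_- 1ℤ) (*-comm (+ i) (+ x)) ⟩
        + x * + i - 1ℤ         ≡⟨ cong (_- 1ℤ) (pos-* x i) ⟨
        + (x ℕ.* i) - 1ℤ       ≡⟨ cong (λ z → + z - 1ℤ) 1+yq≡xi ⟨
        + (1 ℕ.+ y ℕ.* q) - 1ℤ ≡⟨ cong (λ z → 1ℤ + z - 1ℤ) (pos-* y q) ⟩
        1ℤ + + y * + q - 1ℤ    ≡⟨ cancel-1 (+ y * + q) ⟩
        + y * + q              ∎))
        where
        open ≡-Reasoning
        cancel-1 : ∀ a → 1ℤ + a - 1ℤ ≡ a
        cancel-1 = solve-∀
      from-Bézout (Bézout.-+ x y 1+xi≡yq) = from-integer (- + x) (divides (- + y) (begin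
        + i * - + x - 1ℤ       ≡⟨ negate (+ i) (+ x) ⟩
        - (1ℤ + + x * + i)     ≡⟨ cong (λ z → - (1ℤ + z)) (pos-* x i) ⟨
        - + (1 ℕ.+ x ℕ.* i)    ≡⟨ cong (λ z → - + z) 1+xi≡yq ⟩
        - + (y ℕ.* q)          ≡⟨ cong -_ (pos-* y q) ⟩
        - (+ y * + q)          ≡⟨ neg-distribˡ-* (+ y) (+ q) ⟩
        - + y * + q            ∎))
        where
        open ≡-Reasoning
        negate : ∀ i x → i * - x - 1ℤ ≡ - (1ℤ + x * i)
        negate = solve-∀

    inverse-unique : ∀ e {i k₁ k₂} → ¬ p ℕ.∣ i → k₁ < p ℕ.^ e → k₂ < p ℕ.^ e →
                     Inverse (p ℕ.^ e) i k₁ → Inverse (p ℕ.^ e) i k₂ → k₁ ≡ k₂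
    inverse-unique e {i} {k₁} {k₂} p∤i k₁<q k₂<q inv₁ inv₂ =
      ∣-difference-below k₁<q k₂<q (p^∣ℤ-cancelˡ e {d = + i} (unit p∤i)
        (subst (_ ∣_) (factor (+ i) (+ k₁) (+ k₂)) (∣m∣n⇒∣m-n inv₁ inv₂)))
      where
      factor : ∀ i a b → (i * a - 1ℤ) - (i * b - 1ℤ) ≡ i * (a - b)
      factor = solve-∀

    Inverse⇒p∤ : ∀ e {i j} → Inverse (p ℕ.^ suc e) i j → ¬ p ℕ.∣ i
    Inverse⇒p∤ e {i} {j} q∣ij-1 p∣i = p∤1 (∣⇒∣ᵤ (subst (+ p ∣_) (cancel (+ i * + j))
      (∣m∣n⇒∣m-n (∣m⇒∣m*n (+ j) (∣ᵤ⇒∣ {k = + p} {i = + i} p∣i)) (∣-trans p∣q q∣ij-1))))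
      where
      cancel : ∀ a → a - (a - 1ℤ) ≡ 1ℤ
      cancel = solve-∀
      p∣q : + p ∣ + (p ℕ.^ suc e)
      p∣q = ∣ᵤ⇒∣ (ℕ.m∣m*n (p ℕ.^ e))

    ∑δ-block : ∀ e {i} → ¬ p ℕ.∣ i → ∑< (p ℕ.^ e) (δ (p ℕ.^ e) i) ≡ 1ℤ
    ∑δ-block e {i} p∤i with inverse-exists e p∤i
    ... | k , k<q , inv = trans (∑-single q k k<q others) (indicator-yes (+ q ∣ℤ? _) inv)
      where
      q = p ℕ.^ e
      others : ∀ j → j < q → j ≢ k → δ q i j ≡ 0ℤ
      others j j<q j≢k = indicator-no (+ q ∣ℤ? _) (λ inv′ → j≢k (inverse-unique e p∤i j<q k<q inv′ inv))

    ∑δ : ∀ e b {i} → ¬ p ℕ.∣ i → ∑< (b ℕ.* p ℕ.^ e) (δ (p ℕ.^ e) i) ≡ + b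
    ∑δ e b {i} p∤i = begin
      ∑< (b ℕ.* q) (δ q i)                                   ≡⟨ ∑.⨁-* q b (δ q i) ⟩
      ∑< b (λ t → ∑< q (λ k → δ q i (t ℕ.* q ℕ.+ k)))
        ≡⟨ ∑.⨁-cong b (λ t _ → ∑.⨁-cong q (λ k _ → δ-periodic q i t k)) ⟩
      ∑< b (λ _ → ∑< q (δ q i))                             ≡⟨ ∑.⨁-cong b (λ _ _ → ∑δ-block e p∤i) ⟩
      ∑< b (λ _ → 1ℤ)                                       ≡⟨ ∑-const b 1ℤ ⟩
      + b * 1ℤ                                              ≡⟨ *-identityʳ (+ b) ⟩
      + b                                                   ∎
      where
      open ≡-Reasoning
      q = p ℕ.^ e

    ∑δ-weighted : ∀ e b F → let q = p ℕ.^ suc e; N = b ℕ.* q in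
      ∑< N (λ i → ∑< N (δ q i) * onUnits F i) ≡ + b * ∑< N (onUnits F)
    ∑δ-weighted e b F = trans (∑.⨁-cong N (λ i _ → weight i)) (∑-*ˡ N (+ b) (onUnits F))
      where
      q = p ℕ.^ suc e
      N = b ℕ.* q
      weight : ∀ i → ∑< N (δ q i) * onUnits F i ≡ + b * onUnits F i
      weight i = case p ∣? i of λ where
        (yes p∣i) → trans (cong (∑< N (δ q i) *_) (onUnits-p∣ p∣i))
                          (trans (*-zeroʳ (∑< N (δ q i))) (sym (trans (cong (+ b *_) (onUnits-p∣ p∣i)) (*-zeroʳ (+ b)))))
        (no  p∤i) → cong (_* onUnits F i) (∑δ (suc e) b p∤i)

    -- Both sides are Σ over the pairs i, j < N with i j ≡ 1 (mod q), weighted by F i and G j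
    -- respectively: each unit below N has exactly b partners.
    ∑-over-inverses : ∀ e b (F G : ℕ → ℤ) → let q = p ℕ.^ suc e; N = b ℕ.* q in
      (∀ i j → i < N → Inverse q i j → F i ≋ G j [mod + q ]) →
      + b * ∑< N (onUnits F) ≋ + b * ∑< N (onUnits G) [mod + q ]
    ∑-over-inverses e b F G F≋G = begin
      + b * ∑< N (onUnits F)                               ≡⟨ ∑δ-weighted e b F ⟨
      ∑< N (λ i → ∑< N (δ q i) * onUnits F i)              ≡⟨ ∑.⨁-cong N (λ i _ → ∑-*ʳ N (onUnits F i) (δ q i)) ⟨
      ∑< N (λ i → ∑< N (λ j → δ q i j * onUnits F i))      ≈⟨ ∑-≋ N (λ i i<N → ∑-≋ N (λ j _ → paired i j i<N)) ⟩
      ∑< N (λ i → ∑< N (λ j → δ q i j * onUnits G j))      ≡⟨ ∑.⨁-swap N N (λ i j → δ q i j * onUnits G j) ⟩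
      ∑< N (λ j → ∑< N (λ i → δ q i j * onUnits G j))
        ≡⟨ ∑.⨁-cong N (λ j _ → ∑.⨁-cong N (λ i _ → cong (_* onUnits G j) (δ-sym q i j))) ⟩
      ∑< N (λ j → ∑< N (λ i → δ q j i * onUnits G j))      ≡⟨ ∑.⨁-cong N (λ j _ → ∑-*ʳ N (onUnits G j) (δ q j)) ⟩
      ∑< N (λ j → ∑< N (δ q j) * onUnits G j)              ≡⟨ ∑δ-weighted e b G ⟩
      + b * ∑< N (onUnits G)                               ∎
      where
      q = p ℕ.^ suc e
      N = b ℕ.* q
      open ≋-Reasoning (+ q)
      paired : ∀ i j → i < N → δ q i j * onUnits F i ≋ δ q i j * onUnits G j [mod + q ]
      paired i j i<N with + q ∣ℤ? (+ i * + j - 1ℤ)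
      ... | no  _   = ≋-reflexive (trans (*-zeroˡ (onUnits F i)) (sym (*-zeroˡ (onUnits G j))))
      ... | yes inv = ≋-*ˡ 1ℤ (subst₂ (_≋_[mod + q ])
        (sym (onUnits-p∤ (Inverse⇒p∤ e inv)))
        (sym (onUnits-p∤ (Inverse⇒p∤ e (subst (λ ij → + q ∣ ij - 1ℤ) (*-comm (+ i) (+ j)) inv))))
        (F≋G i j i<N inv))

    ∑-block-split : ∀ f t → ∑< p (λ k → f (t ℕ.* p ℕ.+ k)) ≡ ∑< p (λ k → onUnits f (t ℕ.* p ℕ.+ k)) + f (t ℕ.* p)
    ∑-block-split f t = begin
      ∑< p (λ k → f (t ℕ.* p ℕ.+ k))                 ≡⟨ ∑-block f t ⟩
      f (t ℕ.* p ℕ.+ 0) + interior f                 ≡⟨ +-comm (f (t ℕ.* p ℕ.+ 0)) (interior f) ⟩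
      interior f + f (t ℕ.* p ℕ.+ 0)                 ≡⟨ cong₂ _+_ interior≡ (cong f (ℕ.+-identityʳ (t ℕ.* p))) ⟩
      0ℤ + interior (onUnits f) + f (t ℕ.* p)
        ≡⟨ cong (λ z → z + interior (onUnits f) + f (t ℕ.* p)) (onUnits-p∣ (block-head t)) ⟨
      onUnits f (t ℕ.* p ℕ.+ 0) + interior (onUnits f) + f (t ℕ.* p) ≡⟨ cong (_+ f (t ℕ.* p)) (∑-block (onUnits f) t) ⟨
      ∑< p (λ k → onUnits f (t ℕ.* p ℕ.+ k)) + f (t ℕ.* p) ∎
      where
      open ≡-Reasoning
      interior : (ℕ → ℤ) → ℤ
      interior h = ∑< (ℕ.pred p) (λ k → h (t ℕ.* p ℕ.+ suc k))
      interior≡ : interior f ≡ 0ℤ + interior (onUnits f)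
      interior≡ = trans (∑.⨁-cong (ℕ.pred p) (λ k k<p-1 → sym (onUnits-p∤ (block-interior t k<p-1))))
                        (sym (+-identityˡ (interior (onUnits f))))

    ∑-units+multiples : ∀ b f → ∑< (b ℕ.* p) f ≡ ∑< (b ℕ.* p) (onUnits f) + ∑< b (λ t → f (t ℕ.* p))
    ∑-units+multiples b f = begin
      ∑< (b ℕ.* p) f                                                        ≡⟨ ∑.⨁-* p b f ⟩
      ∑< b (λ t → ∑< p (λ k → f (t ℕ.* p ℕ.+ k)))                           ≡⟨ ∑.⨁-cong b (λ t _ → ∑-block-split f t) ⟩
      ∑< b (λ t → ∑< p (λ k → onUnits f (t ℕ.* p ℕ.+ k)) + f (t ℕ.* p))      ≡⟨ ∑.⨁-∙ b _ _ ⟩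
      ∑< b (λ t → ∑< p (λ k → onUnits f (t ℕ.* p ℕ.+ k))) + ∑< b (λ t → f (t ℕ.* p))
        ≡⟨ cong (_+ ∑< b (λ t → f (t ℕ.* p))) (∑.⨁-* p b (onUnits f)) ⟨
      ∑< (b ℕ.* p) (onUnits f) + ∑< b (λ t → f (t ℕ.* p))                   ∎
      where open ≡-Reasoning

    ∑-unit-squares : ¬ p ℕ.∣ 6 → ∀ K b → p ℕ.^ K ℕ.∣ b ℕ.* p → + (p ℕ.^ K) ∣ ∑< (b ℕ.* p) (onUnits square)
    ∑-unit-squares p∤6 K b q∣N =
      p^∣ℤ-cancelˡ K {d = + 6} (unit p∤6) (subst (q ∣_) 6∑units (∣m∣n⇒∣m-n q∣6∑all q∣6∑multiples))
      where
      N = b ℕ.* p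
      q = + (p ℕ.^ K)
      q∣bp : q ∣ + b * + p
      q∣bp = subst (q ∣_) (pos-* b p) (∣ᵤ⇒∣ q∣N)
      ∑multiples≡ : ∑< b (λ t → square (t ℕ.* p)) ≡ + p * + p * ∑< b square
      ∑multiples≡ = trans (∑.⨁-cong b (λ t _ → scaled t)) (∑-*ˡ b (+ p * + p) square)
        where
        regroup : ∀ t p → t * p * (t * p) ≡ p * p * (t * t)
        regroup = solve-∀
        scaled : ∀ t → square (t ℕ.* p) ≡ + p * + p * square t
        scaled t = trans (cong (λ z → z * z) (pos-* t p)) (regroup (+ t) (+ p))
      q∣6∑all : q ∣ + 6 * ∑< N square
      q∣6∑all = subst (q ∣_) (sym (trans (6∑i²<n N) (cong (λ n → (n - 1ℤ) * n * (+ 2 * n - 1ℤ)) (pos-* b p))))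
        (subst (q ∣_) (rearrange (+ b * + p)) (∣n⇒∣m*n ((+ b * + p - 1ℤ) * (+ 2 * (+ b * + p) - 1ℤ)) q∣bp))
        where
        rearrange : ∀ n → (n - 1ℤ) * (+ 2 * n - 1ℤ) * n ≡ (n - 1ℤ) * n * (+ 2 * n - 1ℤ)
        rearrange = solve-∀
      q∣6∑multiples : q ∣ + 6 * ∑< b (λ t → square (t ℕ.* p))
      q∣6∑multiples = subst (q ∣_) (sym 6∑multiples≡) (∣n⇒∣m*n (+ p * (+ b - 1ℤ) * (+ 2 * + b - 1ℤ)) q∣bp)
        where
        rearrange : ∀ p b → p * p * ((b - 1ℤ) * b * (+ 2 * b - 1ℤ)) ≡ p * (b - 1ℤ) * (+ 2 * b - 1ℤ) * (b * p)
        rearrange = solve-∀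
        6∑multiples≡ : + 6 * ∑< b (λ t → square (t ℕ.* p)) ≡ + p * (+ b - 1ℤ) * (+ 2 * + b - 1ℤ) * (+ b * + p)
        6∑multiples≡ = begin
          + 6 * ∑< b (λ t → square (t ℕ.* p))  ≡⟨ cong (+ 6 *_) ∑multiples≡ ⟩
          + 6 * (+ p * + p * ∑< b square)      ≡⟨ x∙yz≈y∙xz (+ 6) (+ p * + p) (∑< b square) ⟩
          + p * + p * (+ 6 * ∑< b square)      ≡⟨ cong (+ p * + p *_) (6∑i²<n b) ⟩
          + p * + p * ((+ b - 1ℤ) * + b * (+ 2 * + b - 1ℤ)) ≡⟨ rearrange (+ p) (+ b) ⟩
          + p * (+ b - 1ℤ) * (+ 2 * + b - 1ℤ) * (+ b * + p) ∎
          where open ≡-Reasoning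
      6∑units : + 6 * ∑< N square - + 6 * ∑< b (λ t → square (t ℕ.* p)) ≡ + 6 * ∑< N (onUnits square)
      6∑units = begin
        + 6 * ∑< N square - + 6 * multiples  ≡⟨ cong (λ z → + 6 * z - + 6 * multiples) (∑-units+multiples b square) ⟩
        + 6 * (∑< N (onUnits square) + multiples) - + 6 * multiples ≡⟨ cancel (+ 6) (∑< N (onUnits square)) multiples ⟩
        + 6 * ∑< N (onUnits square)          ∎
        where
        open ≡-Reasoning
        multiples = ∑< b (λ t → square (t ℕ.* p))
        cancel : ∀ c a m → c * (a + m) - c * m ≡ c * a
        cancel = solve-∀

    W≋D*inverse : ∀ e N {i j} → i < N → Inverse (p ℕ.^ suc e) i j → W N i ≋ D N * + j [mod + (p ℕ.^ suc e) ]
    W≋D*inverse e N {i} {j} i<N inv = ≋-intro (subst (_ ∣_) W-Dj (∣n⇒∣m*n (- W N i) inv))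
      where
      factor : ∀ w i j → - w * (i * j - 1ℤ) ≡ w - w * i * j
      factor = solve-∀
      W-Dj : - W N i * (+ i * + j - 1ℤ) ≡ W N i - D N * + j
      W-Dj = trans (factor (W N i) (+ i) (+ j)) (cong (λ d → W N i - d * + j) (W*i≡D N i i<N (Inverse⇒p∤ e inv)))

    -- Modulo q, W N i ≡ D N j for an inverse j of i, so b Q ≡ b D² Σ j² over the units below N.
    p^∣Q : ¬ p ℕ.∣ 6 → ∀ s b → ¬ p ℕ.∣ b → + (p ℕ.^ suc s) ∣ Q (b ℕ.* p ℕ.^ suc s)
    p^∣Q p∤6 s b p∤b = p^∣ℤ-cancelˡ (suc s) {d = + b} (unit p∤b) (≋0⇒∣ (begin
      + b * Q N                                             ≡⟨ cong (+ b *_) (Q≡∑W² N) ⟩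
      + b * ∑< N (onUnits (W² N))
        ≈⟨ ∑-over-inverses s b _ _ (λ i j i<N inv → ≋-* (W≋D*inverse s N i<N inv) (W≋D*inverse s N i<N inv)) ⟩
      + b * ∑< N (onUnits (λ j → D N * + j * (D N * + j)))
        ≡⟨ cong (+ b *_) (∑.⨁-cong N (λ j _ → trans (onUnits-cong j (regroup (D N) (+ j))) (onUnits-*ˡ (D N * D N) square j))) ⟩
      + b * ∑< N (λ j → D N * D N * onUnits square j)       ≡⟨ cong (+ b *_) (∑-*ˡ N (D N * D N) (onUnits square)) ⟩
      + b * (D N * D N * ∑< N (onUnits square))             ≈⟨ ∣⇒≋0 (∣n⇒∣m*n (+ b) (∣n⇒∣m*n (D N * D N) q∣∑units)) ⟩
      0ℤ                                                    ∎))
      where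
      N = b ℕ.* p ℕ.^ suc s
      open ≋-Reasoning (+ (p ℕ.^ suc s))
      regroup : ∀ d j → d * j * (d * j) ≡ d * d * (j * j)
      regroup = solve-∀
      q∣∑units : + (p ℕ.^ suc s) ∣ ∑< N (onUnits square)
      q∣∑units = subst (λ n → + (p ℕ.^ suc s) ∣ ∑< n (onUnits square)) N≡
        (∑-unit-squares p∤6 (suc s) (b ℕ.* p ℕ.^ s) (divides b N≡))
        where
        N≡ : b ℕ.* p ℕ.^ s ℕ.* p ≡ N
        N≡ = trans (ℕ.*-assoc b (p ℕ.^ s) p) (cong (b ℕ.*_) (ℕ.*-comm (p ℕ.^ s) p))

    p^[1+s]∣Q[bp] : ¬ p ℕ.∣ 6 → ∀ s b → p ℕ.^ s ℕ.∣ b → + (p ℕ.^ suc s) ∣ Q (b ℕ.* p)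
    p^[1+s]∣Q[bp] p∤6 s zero    _     = divides 0ℤ refl
    p^[1+s]∣Q[bp] p∤6 s b@(suc _) p^s∣b with valuation b
    ... | s₀ , b′ , b≡p^s₀b′ , p∤b′ =
      ∣-trans (∣ᵤ⇒∣ (ℕ.*-monoʳ-∣ p p^s∣p^s₀)) (subst (λ n → + (p ℕ.^ suc s₀) ∣ Q n) N≡ (p^∣Q p∤6 s₀ b′ p∤b′))
      where
      p^s∣p^s₀ : p ℕ.^ s ℕ.∣ p ℕ.^ s₀
      p^s∣p^s₀ = p^∣-cancelˡ s p∤b′ (subst (p ℕ.^ s ℕ.∣_) (trans b≡p^s₀b′ (ℕ.*-comm (p ℕ.^ s₀) b′)) p^s∣b)
      regroup : ∀ b′ p q → b′ ℕ.* (p ℕ.* q) ≡ q ℕ.* b′ ℕ.* p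
      regroup = ℕ.solve-∀
      N≡ : b′ ℕ.* p ℕ.^ suc s₀ ≡ b ℕ.* p
      N≡ = trans (regroup b′ p (p ℕ.^ s₀)) (cong (ℕ._* p) (sym b≡p^s₀b′))

    -- Jacobsthal's congruence

    pred-p-even : ¬ p ℕ.∣ 2 → ∃ λ h → ℕ.pred p ≡ h ℕ.+ h
    pred-p-even p∤2 with p ℕ.% 2 | ℕ.m≡m%n+[m/n]*n p 2 | ℕ.m%n<n p 2
    ... | 0 | p≡[p/2]*2 | _ with prime⇒irreducible p-prime (divides (p ℕ./ 2) p≡[p/2]*2)
    ...   | inj₁ ()
    ...   | inj₂ refl = ⊥-elim (p∤2 ℕ.∣-refl)
    pred-p-even p∤2 | 1 | p≡1+[p/2]*2 | _ = p ℕ./ 2 , (begin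
      ℕ.pred p                      ≡⟨ cong ℕ.pred p≡1+[p/2]*2 ⟩
      p ℕ./ 2 ℕ.* 2                 ≡⟨ ℕ.*-comm (p ℕ./ 2) 2 ⟩
      p ℕ./ 2 ℕ.+ (p ℕ./ 2 ℕ.+ 0)   ≡⟨ cong (p ℕ./ 2 ℕ.+_) (ℕ.+-identityʳ (p ℕ./ 2)) ⟩
      p ℕ./ 2 ℕ.+ p ℕ./ 2           ∎)
      where open ≡-Reasoning
    pred-p-even p∤2 | suc (suc _) | _ | s≤s (s≤s ())

    negatedUnit : ℕ → ℤ
    negatedUnit i with p ∣? i
    ... | yes _ = 1ℤ
    ... | no  _ = - + i

    negatedUnit-p∣ : ∀ {i} → p ℕ.∣ i → negatedUnit i ≡ 1ℤ
    negatedUnit-p∣ {i} p∣i with p ∣? i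
    ... | yes _   = refl
    ... | no  p∤i = ⊥-elim (p∤i p∣i)

    negatedUnit-p∤ : ∀ {i} → ¬ p ℕ.∣ i → negatedUnit i ≡ - + i
    negatedUnit-p∤ {i} p∤i with p ∣? i
    ... | yes p∣i = ⊥-elim (p∤i p∣i)
    ... | no  _   = refl

    ∏-negatedUnit-block : ¬ p ℕ.∣ 2 → ∀ t →
      ∏< p (λ k → negatedUnit (t ℕ.* p ℕ.+ k)) ≡ ∏< p (λ k → unitFactor 0ℤ (t ℕ.* p ℕ.+ k))
    ∏-negatedUnit-block p∤2 t with pred-p-even p∤2
    ... | h , p-1≡h+h = begin
      ∏< p (λ k → negatedUnit (t ℕ.* p ℕ.+ k))                ≡⟨ ∏-block negatedUnit t ⟩
      negatedUnit (t ℕ.* p ℕ.+ 0) * ∏< (ℕ.pred p) (λ k → negatedUnit (t ℕ.* p ℕ.+ suc k))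
        ≡⟨ cong₂ _*_ (negatedUnit-p∣ (block-head t)) (∏.⨁-cong (ℕ.pred p) (λ k k< → negatedUnit-p∤ (block-interior t k<))) ⟩
      1ℤ * ∏< (ℕ.pred p) (λ k → - + (t ℕ.* p ℕ.+ suc k))      ≡⟨ *-identityˡ _ ⟩
      ∏< (ℕ.pred p) (λ k → - + (t ℕ.* p ℕ.+ suc k))           ≡⟨ ∏-neg (ℕ.pred p) (λ k → + (t ℕ.* p ℕ.+ suc k)) ⟩
      -1ℤ ^ ℕ.pred p * block-interior-product t                ≡⟨ cong (λ e → -1ℤ ^ e * block-interior-product t) p-1≡h+h ⟩
      -1ℤ ^ (h ℕ.+ h) * block-interior-product t               ≡⟨ cong (_* block-interior-product t) (-1^[n+n]≡1 h) ⟩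
      1ℤ * block-interior-product t                            ≡⟨ *-identityˡ _ ⟩
      block-interior-product t                                 ≡⟨ D-block t ⟨
      ∏< p (λ k → unitFactor 0ℤ (t ℕ.* p ℕ.+ k))              ∎
      where open ≡-Reasoning

    unitFactor-reflect : ∀ N i → p ℕ.∣ N → i ≤ N → unitFactor (- + N) (N ∸ i) ≡ negatedUnit i
    unitFactor-reflect N i p∣N i≤N = case p ∣? i of λ where
        (yes p∣i) → trans (unitFactor-p∣ (ℕ.∣m+n∣m⇒∣n (subst (p ℕ.∣_) N≡i+[N∸i] p∣N) p∣i)) (sym (negatedUnit-p∣ p∣i))
        (no  p∤i) → begin
          unitFactor (- + N) (N ∸ i) ≡⟨ unitFactor-p∤ (λ p∣N∸i → p∤i (ℕ.∣m+n∣m⇒∣n (subst (p ℕ.∣_) (trans N≡i+[N∸i] (ℕ.+-comm i (N ∸ i))) p∣N) p∣N∸i)) ⟩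
          - + N + + (N ∸ i)           ≡⟨ cong (λ n → - + n + + (N ∸ i)) N≡i+[N∸i] ⟩
          - + (i ℕ.+ (N ∸ i)) + + (N ∸ i) ≡⟨ cong (λ n → - n + + (N ∸ i)) (pos-+ i (N ∸ i)) ⟩
          - (+ i + + (N ∸ i)) + + (N ∸ i) ≡⟨ cancel (+ i) (+ (N ∸ i)) ⟩
          - + i                       ≡⟨ negatedUnit-p∤ p∤i ⟨
          negatedUnit i               ∎
      where
      open ≡-Reasoning
      N≡i+[N∸i] : N ≡ i ℕ.+ (N ∸ i)
      N≡i+[N∸i] = sym (ℕ.m+[n∸m]≡n i≤N)
      cancel : ∀ a b → - (a + b) + b ≡ - a
      cancel = solve-∀

    -- Reflect i ↦ N − i; every block of p consecutive integers contains p − 1 units, an even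
    -- number of sign changes.
    P[bp,-bp]≡D : ¬ p ℕ.∣ 2 → ∀ b → P (b ℕ.* p) (- + (b ℕ.* p)) ≡ D (b ℕ.* p)
    P[bp,-bp]≡D p∤2 b = begin
      P N y                                          ≡⟨ *-identityʳ (P N y) ⟨
      P N y * 1ℤ                                     ≡⟨ cong (P N y *_) (unitFactor-p∣ p∣N) ⟨
      ∏< (suc N) (unitFactor y)                      ≡⟨ ∏.⨁-reverse (suc N) (unitFactor y) ⟩
      ∏< (suc N) (λ i → unitFactor y (N ∸ i))        ≡⟨ ∏.⨁-cong (suc N) (λ i i<1+N → unitFactor-reflect N i p∣N (ℕ.≤-pred i<1+N)) ⟩
      ∏< N negatedUnit * negatedUnit N               ≡⟨ cong (∏< N negatedUnit *_) (negatedUnit-p∣ p∣N) ⟩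
      ∏< N negatedUnit * 1ℤ                          ≡⟨ *-identityʳ (∏< N negatedUnit) ⟩
      ∏< N negatedUnit                               ≡⟨ ∏.⨁-* p b negatedUnit ⟩
      ∏< b (λ t → ∏< p (λ k → negatedUnit (t ℕ.* p ℕ.+ k)))    ≡⟨ ∏.⨁-cong b (λ t _ → ∏-negatedUnit-block p∤2 t) ⟩
      ∏< b (λ t → ∏< p (λ k → unitFactor 0ℤ (t ℕ.* p ℕ.+ k))) ≡⟨ ∏.⨁-* p b (unitFactor 0ℤ) ⟨
      D N                                            ∎
      where
      open ≡-Reasoning
      N = b ℕ.* p
      y = - + N
      p∣N : p ℕ.∣ N
      p∣N = n∣m*n b

    Jacobsthal-core : ¬ p ℕ.∣ 6 → ∀ s b c → p ℕ.^ s ℕ.∣ b → p ℕ.^ s ℕ.∣ c →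
      let t = + (p ℕ.^ suc s) in P (b ℕ.* p) (+ (c ℕ.* p)) ≋ D (b ℕ.* p) [mod t * t * t ]
    Jacobsthal-core p∤6 s zero      c _     _     = ≋-refl
    Jacobsthal-core p∤6 s b@(suc _) c p^s∣b p^s∣c =
      ≋-intro (subst (t * t * t ∣_) (sym P-D) (cube∣-near-root (V N) (S₁ N) x y (V-diff N) S₁≡ t∣x t∣y t∣V0))
      where
      t = + (p ℕ.^ suc s)
      N = b ℕ.* p
      x = + (c ℕ.* p)
      y = - + N
      t∣x : t ∣ x
      t∣x = ∣ᵤ⇒∣ (subst (p ℕ.^ suc s ℕ.∣_) (ℕ.*-comm p c) (ℕ.*-monoʳ-∣ p p^s∣c))
      t∣y : t ∣ y
      t∣y = ∣m⇒∣-m (∣ᵤ⇒∣ (subst (p ℕ.^ suc s ℕ.∣_) (ℕ.*-comm p b) (ℕ.*-monoʳ-∣ p p^s∣b)))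
      y≢0 : y ≢ 0ℤ
      y≢0 y≡0 = ℕ.≢-nonZero⁻¹ N {{ℕ.m*n≢0 b p}} (+-injective (neg-injective y≡0))
      S₁≡ : S₁ N ≡ - y * V N y
      S₁≡ = linear-at-root (D N) (S₁ N) y (V N y) y≢0 (trans (sym (P-expansion N y)) (P[bp,-bp]≡D (p∤6⇒p∤2 p∤6) b))
      t∣S₁ : t ∣ S₁ N
      t∣S₁ = subst (t ∣_) (sym S₁≡) (∣m⇒∣m*n (V N y) (∣m⇒∣-m t∣y))
      t∣2DV0 : t ∣ + 2 * D N * V N 0ℤ
      t∣2DV0 = subst (t ∣_) (sym (2DV≡S₁²-Q N)) (∣m∣n⇒∣m-n (∣m⇒∣m*n (S₁ N) t∣S₁) (p^[1+s]∣Q[bp] p∤6 s b p^s∣b))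
      t∣V0 : t ∣ V N 0ℤ
      t∣V0 = p^∣ℤ-cancelˡ (suc s) {d = + 2 * D N} (Unit-* {a = + 2} (unit (p∤6⇒p∤2 p∤6)) (D-Unit N)) t∣2DV0
      cancel : ∀ d x s v → d + x * s + x * x * v - d ≡ x * s + x * x * v
      cancel = solve-∀
      P-D : P N x - D N ≡ x * S₁ N + x * x * V N x
      P-D = trans (cong (_- D N) (P-expansion N x)) (cancel (D N) x (S₁ N) (V N x))

    -- Factorials and binomial coefficients of multiples of p

    unitFactor-shift : ∀ {m} k → p ℕ.∣ m → unitFactor 0ℤ (m ℕ.+ k) ≡ unitFactor (+ m) k
    unitFactor-shift {m} k p∣m = case p ∣? k of λ where
      (yes p∣k) → trans (unitFactor-p∣ (ℕ.∣m∣n⇒∣m+n p∣m p∣k)) (sym (unitFactor-p∣ p∣k))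
      (no  p∤k) → trans (unitFactor-p∤ (λ p∣m+k → p∤k (ℕ.∣m+n∣m⇒∣n p∣m+k p∣m))) (trans (pos-+ m k) (sym (unitFactor-p∤ p∤k)))

    D[m+n]≡D[m]*P[n,m] : ∀ m n → p ℕ.∣ m → D (m ℕ.+ n) ≡ D m * P n (+ m)
    D[m+n]≡D[m]*P[n,m] m n p∣m = trans (∏.⨁-+ m n (unitFactor 0ℤ)) (cong (D m *_) (∏.⨁-cong n (λ k _ → unitFactor-shift k p∣m)))

    factorial-block : ∀ t → ∏< p (λ k → + suc (t ℕ.* p ℕ.+ k)) ≡ block-interior-product t * + (suc t ℕ.* p)
    factorial-block t = begin
      ∏< p (λ k → + suc (t ℕ.* p ℕ.+ k))                               ≡⟨ cong (λ n → ∏< n (λ k → + suc (t ℕ.* p ℕ.+ k))) p≡1+pred-p ⟩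
      ∏< (ℕ.pred p) (λ k → + suc (t ℕ.* p ℕ.+ k)) * + suc (t ℕ.* p ℕ.+ ℕ.pred p)
        ≡⟨ cong₂ _*_ (∏.⨁-cong (ℕ.pred p) (λ k _ → cong +_ (sym (ℕ.+-suc (t ℕ.* p) k)))) (cong +_ last) ⟩
      block-interior-product t * + (suc t ℕ.* p)                       ∎
      where
      open ≡-Reasoning
      last : suc (t ℕ.* p ℕ.+ ℕ.pred p) ≡ suc t ℕ.* p
      last = begin
        suc (t ℕ.* p ℕ.+ ℕ.pred p) ≡⟨ ℕ.+-suc (t ℕ.* p) (ℕ.pred p) ⟨
        t ℕ.* p ℕ.+ suc (ℕ.pred p) ≡⟨ cong (t ℕ.* p ℕ.+_) p≡1+pred-p ⟨
        t ℕ.* p ℕ.+ p              ≡⟨ ℕ.+-comm (t ℕ.* p) p ⟩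
        suc t ℕ.* p                ∎

    [np]!≡p^n*n!*D[np] : ∀ n → + ((n ℕ.* p) !) ≡ + (p ℕ.^ n) * + (n !) * D (n ℕ.* p)
    [np]!≡p^n*n!*D[np] zero    = refl
    [np]!≡p^n*n!*D[np] (suc n) = begin
      + ((suc n ℕ.* p) !)                                             ≡⟨ cong (λ m → + (m !)) [1+n]p≡np+p ⟩
      + ((n ℕ.* p ℕ.+ p) !)                                           ≡⟨ +[m!]≡∏ (n ℕ.* p ℕ.+ p) ⟩
      ∏< (n ℕ.* p ℕ.+ p) (λ i → + suc i)                              ≡⟨ ∏.⨁-+ (n ℕ.* p) p (λ i → + suc i) ⟩
      ∏< (n ℕ.* p) (λ i → + suc i) * ∏< p (λ k → + suc (n ℕ.* p ℕ.+ k)) ≡⟨ cong₂ _*_ (sym (+[m!]≡∏ (n ℕ.* p))) (factorial-block n) ⟩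
      + ((n ℕ.* p) !) * (u * + (suc n ℕ.* p))                         ≡⟨ cong₂ (λ a b → a * (u * b)) ([np]!≡p^n*n!*D[np] n) (pos-* (suc n) p) ⟩
      + (p ℕ.^ n) * + (n !) * D (n ℕ.* p) * (u * (+ suc n * + p))     ≡⟨ regroup (+ (p ℕ.^ n)) (+ (n !)) (D (n ℕ.* p)) u (+ suc n) (+ p) ⟩
      (+ p * + (p ℕ.^ n)) * (+ suc n * + (n !)) * (D (n ℕ.* p) * u)  ≡⟨ cong₂ (λ a b → a * b * (D (n ℕ.* p) * u)) (pos-* p (p ℕ.^ n)) (pos-* (suc n) (n !)) ⟨
      + (p ℕ.^ suc n) * + (suc n !) * (D (n ℕ.* p) * u)              ≡⟨ cong (+ (p ℕ.^ suc n) * + (suc n !) *_) D[[1+n]p] ⟨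
      + (p ℕ.^ suc n) * + (suc n !) * D (suc n ℕ.* p)                ∎
      where
      open ≡-Reasoning
      u = block-interior-product n
      +[m!]≡∏ : ∀ m → + (m !) ≡ ∏< m (λ i → + suc i)
      +[m!]≡∏ zero    = refl
      +[m!]≡∏ (suc m) = trans (pos-* (suc m) (m !)) (trans (*-comm (+ suc m) (+ (m !))) (cong (_* + suc m) (+[m!]≡∏ m)))
      [1+n]p≡np+p : suc n ℕ.* p ≡ n ℕ.* p ℕ.+ p
      [1+n]p≡np+p = ℕ.+-comm p (n ℕ.* p)
      regroup : ∀ a b d u s q → a * b * d * (u * (s * q)) ≡ (q * a) * (s * b) * (d * u)
      regroup = solve-∀
      D[[1+n]p] : D (suc n ℕ.* p) ≡ D (n ℕ.* p) * u
      D[[1+n]p] = begin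
        D (suc n ℕ.* p)         ≡⟨ cong D [1+n]p≡np+p ⟩
        D (n ℕ.* p ℕ.+ p)       ≡⟨ ∏.⨁-+ (n ℕ.* p) p (unitFactor 0ℤ) ⟩
        D (n ℕ.* p) * ∏< p (λ k → unitFactor 0ℤ (n ℕ.* p ℕ.+ k)) ≡⟨ cong (D (n ℕ.* p) *_) (D-block n) ⟩
        D (n ℕ.* p) * u         ∎

    p^∣binomial : ∀ a s n j → p ℕ.^ (s ℕ.+ a) ℕ.∣ n → ¬ p ℕ.∣ j → p ℕ.^ a ℕ.∣ n C (p ℕ.^ s ℕ.* j)
    p^∣binomial a s n j p^[s+a]∣n p∤j = p^∣-cancelˡ a p∤j (ℕ.*-cancelˡ-∣ (p ℕ.^ s) {{p^≢0 s}} p^s*p^a∣p^s*j*C)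
      where
      k = p ℕ.^ s ℕ.* j
      instance
        j≢0 : ℕ.NonZero j
        j≢0 = ℕ.≢-nonZero (λ j≡0 → p∤j (subst (p ℕ.∣_) (sym j≡0) (ℕ._∣0 p)))
        k≢0 : ℕ.NonZero k
        k≢0 = ℕ.m*n≢0 (p ℕ.^ s) j {{p^≢0 s}}
      p^s*p^a∣p^s*j*C : p ℕ.^ s ℕ.* p ℕ.^ a ℕ.∣ p ℕ.^ s ℕ.* (j ℕ.* (n C k))
      p^s*p^a∣p^s*j*C = subst₂ ℕ._∣_ (ℕ.^-distribˡ-+-* p s a) (trans (sym (absorption n k)) (ℕ.*-assoc (p ℕ.^ s) j (n C k)))
        (ℕ.∣m⇒∣m*n (ℕ.pred n C ℕ.pred k) p^[s+a]∣n)

    D[bp]*[[b+c]p]C[bp]≡[b+c]Cb*P[bp,cp] : ∀ b c →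
      D (b ℕ.* p) * + ((b ℕ.* p ℕ.+ c ℕ.* p) C (b ℕ.* p)) ≡ + ((b ℕ.+ c) C b) * P (b ℕ.* p) (+ (c ℕ.* p))
    D[bp]*[[b+c]p]C[bp]≡[b+c]Cb*P[bp,cp] b c = *-cancelʳ-≡ _ _ K {{K≢0}} (trans lhs·K (sym rhs·K))
      where
      bp = b ℕ.* p
      cp = c ℕ.* p
      big = + ((bp ℕ.+ cp) C bp)
      small = + ((b ℕ.+ c) C b)
      fb = + (p ℕ.^ b) * + (b !)
      fc = + (p ℕ.^ c) * + (c !)
      K = fb * fc * D cp
      K≢0 : NonZero K
      K≢0 = i*j≢0 (fb * fc) (D cp) {{i*j≢0 fb fc {{f≢0 b}} {{f≢0 c}}}} {{Unit⇒NonZero (D-Unit cp)}}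
        where
        f≢0 : ∀ a → NonZero (+ (p ℕ.^ a) * + (a !))
        f≢0 a = i*j≢0 (+ (p ℕ.^ a)) (+ (a !)) {{p^≢0 a}} {{a ℕ.!≢0}}
      open ≡-Reasoning
      lhs·K : D bp * big * K ≡ + ((bp ℕ.+ cp) !)
      lhs·K = begin
        D bp * big * (fb * fc * D cp)          ≡⟨ regroup (D bp) big fb fc (D cp) ⟩
        big * (fb * D bp * (fc * D cp))        ≡⟨ cong₂ (λ x y → big * (x * y)) ([np]!≡p^n*n!*D[np] b) ([np]!≡p^n*n!*D[np] c) ⟨
        big * (+ (bp !) * + (cp !))            ≡⟨ cong (big *_) (pos-* (bp !) (cp !)) ⟨
        big * + (bp ! ℕ.* cp !)                ≡⟨ pos-* ((bp ℕ.+ cp) C bp) (bp ! ℕ.* cp !) ⟨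
        + (((bp ℕ.+ cp) C bp) ℕ.* (bp ! ℕ.* cp !)) ≡⟨ cong +_ ([k+l]Ck*k!*l!≡[k+l]! bp cp) ⟩
        + ((bp ℕ.+ cp) !)                      ∎
        where
        regroup : ∀ d x f g e → d * x * (f * g * e) ≡ x * (f * d * (g * e))
        regroup = solve-∀
      rhs·K : small * P bp (+ cp) * K ≡ + ((bp ℕ.+ cp) !)
      rhs·K = begin
        small * P bp (+ cp) * (fb * fc * D cp)                     ≡⟨ regroup small (P bp (+ cp)) (+ (p ℕ.^ b)) (+ (b !)) (+ (p ℕ.^ c)) (+ (c !)) (D cp) ⟩
        + (p ℕ.^ b) * + (p ℕ.^ c) * (small * (+ (b !) * + (c !))) * (D cp * P bp (+ cp))
          ≡⟨ cong₂ (λ x y → x * y * (D cp * P bp (+ cp))) p^b*p^c [b+c]! ⟩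
        + (p ℕ.^ (b ℕ.+ c)) * + ((b ℕ.+ c) !) * (D cp * P bp (+ cp)) ≡⟨ cong (+ (p ℕ.^ (b ℕ.+ c)) * + ((b ℕ.+ c) !) *_) D[[b+c]p] ⟨
        + (p ℕ.^ (b ℕ.+ c)) * + ((b ℕ.+ c) !) * D ((b ℕ.+ c) ℕ.* p) ≡⟨ [np]!≡p^n*n!*D[np] (b ℕ.+ c) ⟨
        + (((b ℕ.+ c) ℕ.* p) !)                                    ≡⟨ cong (λ n → + (n !)) (ℕ.*-distribʳ-+ p b c) ⟩
        + ((bp ℕ.+ cp) !)                                          ∎
        where
        p^b*p^c : + (p ℕ.^ b) * + (p ℕ.^ c) ≡ + (p ℕ.^ (b ℕ.+ c))
        p^b*p^c = trans (sym (pos-* (p ℕ.^ b) (p ℕ.^ c))) (cong +_ (sym (ℕ.^-distribˡ-+-* p b c)))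
        [b+c]! : small * (+ (b !) * + (c !)) ≡ + ((b ℕ.+ c) !)
        [b+c]! = trans (cong (small *_) (sym (pos-* (b !) (c !))))
                       (trans (sym (pos-* ((b ℕ.+ c) C b) (b ! ℕ.* c !))) (cong +_ ([k+l]Ck*k!*l!≡[k+l]! b c)))
        D[[b+c]p] : D ((b ℕ.+ c) ℕ.* p) ≡ D cp * P bp (+ cp)
        D[[b+c]p] = trans (cong D (trans (ℕ.*-distribʳ-+ p b c) (ℕ.+-comm bp cp))) (D[m+n]≡D[m]*P[n,m] cp bp (n∣m*n c))
        regroup : ∀ s q f g h k d → s * q * (f * g * (h * k) * d) ≡ f * h * (s * (g * k)) * (d * q)
        regroup = solve-∀

    p^[eA+3[s+1]]≡ : ∀ e A s → + (p ℕ.^ (e ℕ.* A ℕ.+ 3 ℕ.* suc s)) ≡ (+ (p ℕ.^ e)) ^ A * (+ (p ℕ.^ suc s) * + (p ℕ.^ suc s) * + (p ℕ.^ suc s))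
    p^[eA+3[s+1]]≡ e A s = begin
      + (p ℕ.^ (e ℕ.* A ℕ.+ 3 ℕ.* suc s))                ≡⟨ cong +_ (ℕ.^-distribˡ-+-* p (e ℕ.* A) (3 ℕ.* suc s)) ⟩
      + (p ℕ.^ (e ℕ.* A) ℕ.* p ℕ.^ (3 ℕ.* suc s))        ≡⟨ pos-* (p ℕ.^ (e ℕ.* A)) (p ℕ.^ (3 ℕ.* suc s)) ⟩
      + (p ℕ.^ (e ℕ.* A)) * + (p ℕ.^ (3 ℕ.* suc s))      ≡⟨ cong₂ (λ m n → + m * + n) (sym (ℕ.^-*-assoc p e A)) (trans (cong (p ℕ.^_) (ℕ.*-comm 3 (suc s))) (sym (ℕ.^-*-assoc p (suc s) 3))) ⟩
      + ((p ℕ.^ e) ℕ.^ A) * + ((p ℕ.^ suc s) ℕ.^ 3)      ≡⟨ cong₂ _*_ (pos-^ (p ℕ.^ e) A) (trans (pos-^ (p ℕ.^ suc s) 3) (cube (+ (p ℕ.^ suc s)))) ⟩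
      (+ (p ℕ.^ e)) ^ A * (+ (p ℕ.^ suc s) * + (p ℕ.^ suc s) * + (p ℕ.^ suc s)) ∎
      where
      open ≡-Reasoning
      cube : ∀ t → t * (t * (t * 1ℤ)) ≡ t * t * t
      cube = solve-∀

    binomial-power-congruence : ¬ p ℕ.∣ 6 → ∀ A B b c s e → p ℕ.^ s ℕ.∣ b → p ℕ.^ s ℕ.∣ c → p ℕ.^ e ℕ.∣ (b ℕ.+ c) C b →
      (+ ((b ℕ.* p ℕ.+ c ℕ.* p) C (b ℕ.* p))) ^ A * (+ ((b ℕ.* p ℕ.+ b ℕ.* p) C (b ℕ.* p))) ^ B
        ≋ (+ ((b ℕ.+ c) C b)) ^ A * (+ ((b ℕ.+ b) C b)) ^ B [mod + (p ℕ.^ (e ℕ.* A ℕ.+ 3 ℕ.* suc s)) ]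
    binomial-power-congruence p∤6 A B b c s e p^s∣b p^s∣c p^e∣C =
      ≋-intro (p^∣ℤ-cancelˡ (e ℕ.* A ℕ.+ 3 ℕ.* suc s) {d = d ^ A * d ^ B} (Unit-* (Unit-^ A (D-Unit bp)) (Unit-^ B (D-Unit bp)))
        (subst₂ _∣_ (sym (p^[eA+3[s+1]]≡ e A s)) (sym scaled) M∣rhs))
      where
      bp = b ℕ.* p
      t = + (p ℕ.^ suc s)
      d = D bp
      x = + ((bp ℕ.+ c ℕ.* p) C bp)
      z = + ((bp ℕ.+ bp) C bp)
      y = + ((b ℕ.+ c) C b)
      w = + ((b ℕ.+ b) C b)
      X = P bp (+ (c ℕ.* p))
      Z = P bp (+ bp)
      scaled : d ^ A * d ^ B * (x ^ A * z ^ B - y ^ A * w ^ B) ≡ y ^ A * w ^ B * (X ^ A * Z ^ B - d ^ A * d ^ B)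
      scaled = ^-scaled-difference d x y X z w Z A B (D[bp]*[[b+c]p]C[bp]≡[b+c]Cb*P[bp,cp] b c) (D[bp]*[[b+c]p]C[bp]≡[b+c]Cb*P[bp,cp] b b)
      M∣rhs : (+ (p ℕ.^ e)) ^ A * (t * t * t) ∣ y ^ A * w ^ B * (X ^ A * Z ^ B - d ^ A * d ^ B)
      M∣rhs = *-pres-∣ (∣m⇒∣m*n (w ^ B) (^-pres-∣ A (∣ᵤ⇒∣ p^e∣C)))
        (∣-difference (≋-* (≋-^ A (Jacobsthal-core p∤6 s b c p^s∣b p^s∣c)) (≋-^ B (Jacobsthal-core p∤6 s b b p^s∣b p^s∣b))))

    -- The sum C(n, A, B)

    ∑-onUnits≋0 : ∀ N {M f} → (∀ k → ¬ p ℕ.∣ k → M ∣ f k) → ∑< N (onUnits f) ≋ 0ℤ [mod M ]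
    ∑-onUnits≋0 N {M} {f} M∣f = ≋-trans (∑-≋ N (λ k _ → term k)) (≋-reflexive (∑.⨁-ε N (λ _ _ → refl)))
      where
      term : ∀ k → onUnits f k ≋ 0ℤ [mod M ]
      term k = case p ∣? k of λ where
        (yes p∣k) → ≋-reflexive (onUnits-p∣ p∣k)
        (no  p∤k) → ∣⇒≋0 (subst (M ∣_) (sym (onUnits-p∤ p∤k)) (M∣f k p∤k))

    sumTo-multiples : ∀ (F : ℕ → ℕ) M n → (∀ k → ¬ p ℕ.∣ k → M ∣ + F k) →
      + sumTo (n ℕ.* p) F ≋ + sumTo n (λ j → F (j ℕ.* p)) [mod M ]
    sumTo-multiples F M n M∣F = begin
      + sumTo (n ℕ.* p) F                                   ≡⟨ sumTo≡∑< (n ℕ.* p) F ⟩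
      ∑< (n ℕ.* p) F′ + F′ (n ℕ.* p)                         ≡⟨ cong (_+ F′ (n ℕ.* p)) (∑-units+multiples n F′) ⟩
      ∑< (n ℕ.* p) (onUnits F′) + ∑< n (λ t → F′ (t ℕ.* p)) + F′ (n ℕ.* p) ≈⟨ ≋-+ (≋-+ (∑-onUnits≋0 (n ℕ.* p) M∣F) ≋-refl) ≋-refl ⟩
      0ℤ + ∑< n (λ t → F′ (t ℕ.* p)) + F′ (n ℕ.* p)          ≡⟨ cong (_+ F′ (n ℕ.* p)) (+-identityˡ (∑< n (λ t → F′ (t ℕ.* p)))) ⟩
      ∑< (suc n) (λ t → F′ (t ℕ.* p))                        ≡⟨ sumTo≡∑< n (λ j → F (j ℕ.* p)) ⟨
      + sumTo n (λ j → F (j ℕ.* p))                          ∎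
      where
      open ≋-Reasoning M
      F′ : ℕ → ℤ
      F′ k = + F k

    summand : ℕ → ℕ → ℕ → ℕ → ℕ
    summand A B n k = (n C k) ℕ.^ A ℕ.* ((2 ℕ.* k) C k) ℕ.^ B

    p^∣summand : ∀ A B a N k → p ℕ.^ a ℕ.∣ N → ¬ p ℕ.∣ k → + (p ℕ.^ (a ℕ.* A)) ∣ + summand A B N k
    p^∣summand A B a N k p^a∣N p∤k = subst₂ _∣_ (trans (sym (pos-^ (p ℕ.^ a) A)) (cong +_ (ℕ.^-*-assoc p a A)))
      (sym (pos-^*^ (N C k) ((2 ℕ.* k) C k) A B))
      (∣m⇒∣m*n ((+ ((2 ℕ.* k) C k)) ^ B) (^-pres-∣ A (∣ᵤ⇒∣ p^a∣C)))
      where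
      p^a∣C : p ℕ.^ a ℕ.∣ N C k
      p^a∣C = subst (λ i → p ℕ.^ a ℕ.∣ N C i) (ℕ.*-identityˡ k) (p^∣binomial a 0 N k p^a∣N p∤k)

    -- With c = n − j, either p^r ∣ j, or j = p^s j′ with s < r, p ∤ j′ and then p^{r−s} ∣ C(n, j).
    summand-congruence : ¬ p ℕ.∣ 6 → ∀ A B r K n j → p ℕ.^ r ℕ.∣ n → j ≤ n →
      (∀ s → s ≤ r → K ≤ (r ∸ s) ℕ.* A ℕ.+ 3 ℕ.* suc s) →
      + summand A B (n ℕ.* p) (j ℕ.* p) ≋ + summand A B n j [mod + (p ℕ.^ K) ]
    summand-congruence p∤6 A B r K n j p^r∣n j≤n K≤ = case valuation-split r j of λ where
        (inj₁ p^r∣j) → via r 0 ℕ.≤-refl p^r∣j (ℕ.1∣ _) (subst (λ d → K ≤ d ℕ.* A ℕ.+ 3 ℕ.* suc r) (ℕ.n∸n≡0 r) (K≤ r ℕ.≤-refl))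
        (inj₂ (s , s<r , j′ , j≡p^sj′ , p∤j′)) → via s (r ∸ s) (ℕ.<⇒≤ s<r) (divides j′ (trans j≡p^sj′ (ℕ.*-comm (p ℕ.^ s) j′)))
          (subst₂ (λ a i → p ℕ.^ (r ∸ s) ℕ.∣ a C i) (sym j+c≡n) (sym j≡p^sj′)
            (p^∣binomial (r ∸ s) s n j′ (subst (λ e → p ℕ.^ e ℕ.∣ n) (sym (ℕ.m+[n∸m]≡n (ℕ.<⇒≤ s<r))) p^r∣n) p∤j′))
          (K≤ s (ℕ.<⇒≤ s<r))
      where
      c = n ∸ j
      j+c≡n : j ℕ.+ c ≡ n
      j+c≡n = ℕ.m+[n∸m]≡n j≤n
      lhs≡ : + summand A B (n ℕ.* p) (j ℕ.* p) ≡ (+ ((j ℕ.* p ℕ.+ c ℕ.* p) C (j ℕ.* p))) ^ A * (+ ((j ℕ.* p ℕ.+ j ℕ.* p) C (j ℕ.* p))) ^ B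
      lhs≡ = trans (pos-^*^ ((n ℕ.* p) C (j ℕ.* p)) ((2 ℕ.* (j ℕ.* p)) C (j ℕ.* p)) A B)
        (cong₂ (λ a b → (+ (a C (j ℕ.* p))) ^ A * (+ (b C (j ℕ.* p))) ^ B)
          (trans (cong (ℕ._* p) (sym j+c≡n)) (ℕ.*-distribʳ-+ p j c))
          (cong (j ℕ.* p ℕ.+_) (ℕ.+-identityʳ (j ℕ.* p))))
      rhs≡ : + summand A B n j ≡ (+ ((j ℕ.+ c) C j)) ^ A * (+ ((j ℕ.+ j) C j)) ^ B
      rhs≡ = trans (pos-^*^ (n C j) ((2 ℕ.* j) C j) A B)
        (cong₂ (λ a b → (+ (a C j)) ^ A * (+ (b C j)) ^ B) (sym j+c≡n) (cong (j ℕ.+_) (ℕ.+-identityʳ j)))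
      via : ∀ s e → s ≤ r → p ℕ.^ s ℕ.∣ j → p ℕ.^ e ℕ.∣ (j ℕ.+ c) C j → K ≤ e ℕ.* A ℕ.+ 3 ℕ.* suc s →
            + summand A B (n ℕ.* p) (j ℕ.* p) ≋ + summand A B n j [mod + (p ℕ.^ K) ]
      via s e s≤r p^s∣j p^e∣C K≤E = ≋-weaken (∣ᵤ⇒∣ (p^-mono-∣ K≤E)) (subst₂ (_≋_[mod _ ]) (sym lhs≡) (sym rhs≡)
        (binomial-power-congruence p∤6 A B j c s e p^s∣j p^s∣c p^e∣C))
        where
        p^s∣c : p ℕ.^ s ℕ.∣ c
        p^s∣c = ℕ.∣m+n∣m⇒∣n (subst (p ℕ.^ s ℕ.∣_) (sym j+c≡n) (ℕ.∣-trans (p^-mono-∣ s≤r) p^r∣n)) p^s∣j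

    Cfun-congruence : ¬ p ℕ.∣ 6 → ∀ A B r m K → K ≤ A ℕ.* suc r →
      (∀ s → s ≤ r → K ≤ (r ∸ s) ℕ.* A ℕ.+ 3 ℕ.* suc s) →
      + Cfun (m ℕ.* p ℕ.^ suc r) A B ≋ + Cfun (m ℕ.* p ℕ.^ r) A B [mod + (p ℕ.^ K) ]
    Cfun-congruence p∤6 A B r m K K≤A[1+r] K≤ = begin
      + Cfun (m ℕ.* p ℕ.^ suc r) A B                      ≡⟨ cong (λ N → + sumTo N (summand A B N)) mp^[1+r]≡np ⟩
      + sumTo (n ℕ.* p) (summand A B (n ℕ.* p))           ≈⟨ sumTo-multiples (summand A B (n ℕ.* p)) (+ (p ℕ.^ K)) n p^K∣nonmultiple ⟩
      + sumTo n (λ j → summand A B (n ℕ.* p) (j ℕ.* p))   ≈⟨ sumTo-≋ n (λ j j≤n → summand-congruence p∤6 A B r K n j (n∣m*n m) j≤n K≤) ⟩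
      + Cfun n A B                                        ∎
      where
      open ≋-Reasoning (+ (p ℕ.^ K))
      n = m ℕ.* p ℕ.^ r
      mp^[1+r]≡np : m ℕ.* p ℕ.^ suc r ≡ n ℕ.* p
      mp^[1+r]≡np = trans (cong (m ℕ.*_) (ℕ.*-comm p (p ℕ.^ r))) (sym (ℕ.*-assoc m (p ℕ.^ r) p))
      p^K∣nonmultiple : ∀ k → ¬ p ℕ.∣ k → + (p ℕ.^ K) ∣ + summand A B (n ℕ.* p) k
      p^K∣nonmultiple k p∤k = ∣-trans (∣ᵤ⇒∣ (p^-mono-∣ (subst (K ≤_) (ℕ.*-comm A (suc r)) K≤A[1+r])))
        (p^∣summand A B (suc r) (n ℕ.* p) k (subst (p ℕ.^ suc r ℕ.∣_) mp^[1+r]≡np (n∣m*n m)) p∤k)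


open import Defs
open import Data.Nat using (ℕ; suc; _+_; _*_; _^_; _<_; _≤_; _>_; _≥_; _∸_)
open import Data.Nat.Properties using (<⇒≱; ≤-trans; ≤-refl; n≤1+n; m+[n∸m]≡n; +-mono-≤; *-monoʳ-≤; *-monoˡ-≤; module ≤-Reasoning)
open import Data.Nat.Divisibility using (_∣_; ∣⇒≤)
open import Data.Nat.Primality using (Prime; euclidsLemma)
open import Data.Nat.Tactic.RingSolver using (solve-∀)
open import Data.Integer.Divisibility.Signed using (∣⇒∣ᵤ)
open import Data.Product using (_×_; _,_)
open import Data.Sum using (inj₁; inj₂)
open import Relation.Nullary using (¬_)
open import Relation.Binary.PropositionalEquality using (_≡_; cong)
open BinomialSumCongruences using (Cfun-congruence; ∣-difference)

prime>3⇒∤6 : ∀ {p} → Prime p → 3 < p → ¬ p ∣ 6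
prime>3⇒∤6 {p} p-prime 3<p p∣6 with euclidsLemma 2 3 p-prime p∣6
... | inj₁ p∣2 = <⇒≱ 3<p (≤-trans (∣⇒≤ p∣2) (n≤1+n 2))
... | inj₂ p∣3 = <⇒≱ 3<p (∣⇒≤ p∣3)

exponent-bound : ∀ k A r s → k ≤ A → k ≤ 3 → s ≤ r → k * suc r ≤ (r ∸ s) * A + 3 * suc s
exponent-bound k A r s k≤A k≤3 s≤r = begin
  k * suc r               ≡⟨ cong (λ n → k * suc n) (m+[n∸m]≡n s≤r) ⟨
  k * suc (s + d)         ≡⟨ split k s d ⟩
  d * k + k * suc s       ≤⟨ +-mono-≤ (*-monoʳ-≤ d k≤A) (*-monoˡ-≤ (suc s) k≤3) ⟩
  d * A + 3 * suc s       ∎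
  where
  open ≤-Reasoning
  d = r ∸ s
  split : ∀ k s d → k * suc (s + d) ≡ d * k + k * suc s
  split = solve-∀

theorem1p1 : (A B p m r : ℕ) → Prime p → p > 3 → r ≥ 1 →
    ((A ≥ 3 → Cfun (m * p ^ r) A B ≡ Cfun (m * p ^ (r ∸ 1)) A B [mod p ^ (3 * r) ])
      × (Cfun (m * p ^ r) 2 B ≡ Cfun (m * p ^ (r ∸ 1)) 2 B [mod p ^ (2 * r) ]))
theorem1p1 A B p m (suc r) p-prime p>3 _ =
    (λ A≥3 → ∣⇒∣ᵤ (∣-difference (Cfun-congruence p-prime p∤6 A B r m (3 * suc r)
                     (*-monoˡ-≤ (suc r) A≥3) (λ s s≤r → exponent-bound 3 A r s A≥3 ≤-refl s≤r))))
  , ∣⇒∣ᵤ (∣-difference (Cfun-congruence p-prime p∤6 2 B r m (2 * suc r)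
                     ≤-refl (λ s s≤r → exponent-bound 2 2 r s ≤-refl (n≤1+n 2) s≤r)))
  where
  p∤6 : ¬ p ∣ 6
  p∤6 = prime>3⇒∤6 p-prime p>3
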